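{- For every integer $n\ge 27$, every integer in the interval $\left[-\binom{\lfloor(n-15)/3\rfloor}{2},\ \binom{\lfloor(n-15)/3\rfloor}{2}\right]$ is an eigenvalue of the transposition graph $\mathrm{Cay}(S_n,T_n)$.
   Context: $S_n$ is the symmetric group on $\{1,\dots,n\}$ and $T_n\subseteq S_n$ is the set of all transpositions. The transposition graph $\mathrm{Cay}(S_n,T_n)$ is the Cayley graph with vertex set $S_n$ in which $f,g\in S_n$ are adjacent iff $fg^{ -1}\in T_n$. Its eigenvalues are the eigenvalues of its adjacency matrix. -}

module Defs where

open import Data.Nat using (ℕ; _<ᵇ_; _∸_; _/_)
open import Data.Nat.Combinatorics using (_C_)
open import Data.Fin using (Fin; toℕ)
open import Data.Fin.Permutation using (Permutation′; transpose; _∘ₚ_; _≈_)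
open import Data.Integer using (ℤ; _+_; _*_; -_; _≤_; +_; 0ℤ)
open import Data.List using (List; map; sum; foldr)
open import Data.List using (allFin)
open import Data.Bool using (if_then_else_)
open import Data.Product using (Σ; _×_; ∃)
open import Relation.Binary.PropositionalEquality using (_≡_; _≢_)

Sym : ℕ → Set
Sym n = Permutation′ n

Σℤ : ∀ n → (Fin n → ℤ) → ℤ
Σℤ n f = foldr _+_ 0ℤ (map f (allFin n))

-- A vector on the vertex set S_n: a function S_n → ℤ respecting equality of
-- permutations (pointwise equality, the stdlib's _≈_ on Permutation).
Respects≈ : ∀ n → (Sym n → ℤ) → Set
Respects≈ n v = ∀ (σ τ : Sym n) → σ ≈ τ → v σ ≡ v τ

-- (A v)(g) for the adjacency matrix A of Cay(S_n, T_n):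
-- the neighbours of g are the f with f g⁻¹ = t ∈ T_n, i.e. f = t ∘ g
-- (as functions; in stdlib's diagrammatic notation, g ∘ₚ t).
-- Each transposition t = (i j) with i < j is counted once.
adjApply : ∀ n → (Sym n → ℤ) → Sym n → ℤ
adjApply n v g =
  Σℤ n (λ i → Σℤ n (λ j →
    if toℕ i <ᵇ toℕ j then v (g ∘ₚ transpose i j) else 0ℤ))

IsTranspositionGraphEigenvalue : ℕ → ℤ → Set
IsTranspositionGraphEigenvalue n λ′ =
  Σ (Sym n → ℤ) λ v →
    Respects≈ n v ×
    (∃ λ (σ : Sym n) → v σ ≢ 0ℤ) ×
    (∀ (g : Sym n) → adjApply n v g ≡ λ′ * v g)

bound : ℕ → ℕ
bound n = ((n ∸ 15) / 3) C 2

{-# OPTIONS --safe #-}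
module Submission where

-- Fill a Young diagram λ ⊢ n column by column with 1, …, n and send σ ∈ Sₙ to
-- the product, over the columns, of the Vandermonde determinants of the
-- positions σ⁻¹(i) of the entries of that column. A transposition inside a
-- column negates this product. For an entry outside the first column, the
-- product is a polynomial of degree < (length of the first column) in its
-- position, so by Lagrange interpolation its swaps with the first column sum
-- to the product itself. Induction on the columns then shows that this vector
-- is an eigenvector whose eigenvalue is the content Σ (column − row) of λ.
--
-- So it suffices to realise every k with |k| ≤ C(⌊(n − 15)/3⌋, 2) as the
-- content of a partition of n; conjugation negates contents. In Frobenius
-- coordinates the content is Σ (T aᵢ − T bᵢ) with T x = x(x + 1)/2. Writing
-- n = 2h + 1 + s, two hooks whose arms exceed their legs by δ and δ + 1,
-- around a single column of s cells, realise δ(h + 1) + u − C(s, 2); with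
-- s ≤ 5 chosen suitably this reaches every remainder u once h is large
-- compared with δ. That holds for all n ≥ 126, and a checked search covers
-- the finitely many smaller n.

module Sums where

  open import Data.Nat.Base as ℕ using (ℕ; zero; suc)
  open import Data.Fin.Base using (Fin; zero; suc; _↑ˡ_; _↑ʳ_)
  import Data.Fin.Permutation as Perm
  import Data.Fin.Permutation.Components as PC
  import Data.Fin.Properties as Fin
  open import Data.Integer.Base using (ℤ; 0ℤ; 1ℤ; +_; _+_; _*_)
  import Data.Integer.Properties as ℤ
  open import Data.Sum.Base using (inj₁; inj₂)
  open import Function.Base using (_∘_)
  open import Relation.Binary.PropositionalEquality

  open import Algebra.Properties.Semiring.Sum ℤ.+-*-semiring public
    using (sum; sum-syntax; sum-cong-≗; ∑-comm; *-distribˡ-sum)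
  open import Algebra.Properties.Semiring.Sum ℤ.+-*-semiring
    using (sum-replicate-zero)
  open import Algebra.Properties.CommutativeMonoid.Sum ℤ.*-1-commutativeMonoid public
    using () renaming (sum to prod; sum-cong-≗ to prod-cong-≗)
  open import Algebra.Properties.CommutativeMonoid.Sum ℤ.*-1-commutativeMonoid
    using () renaming (sum-permute to prod-permute)

  sum-const : ∀ n (k : ℤ) → ∑[ i < n ] k ≡ + n * k
  sum-const zero    k = sym (ℤ.*-zeroˡ k)
  sum-const (suc n) k = begin
    k + ∑[ i < n ] k ≡⟨ cong (λ t → k + t) (sum-const n k) ⟩
    k + + n * k      ≡⟨ cong (_+ + n * k) (ℤ.*-identityˡ k) ⟨
    1ℤ * k + + n * k ≡⟨ ℤ.*-distribʳ-+ k (+ 1) (+ n) ⟨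
    + suc n * k      ∎
    where open ≡-Reasoning

  sum-↑ : ∀ a b (f : Fin (a ℕ.+ b) → ℤ) →
          sum f ≡ ∑[ i < a ] f (i ↑ˡ b) + ∑[ j < b ] f (a ↑ʳ j)
  sum-↑ zero    b f = sym (ℤ.+-identityˡ _)
  sum-↑ (suc a) b f = trans (cong (λ t → f zero + t) (sum-↑ a b (f ∘ suc))) (sym (ℤ.+-assoc (f zero) _ _))

  sum-single : ∀ {n} (f : Fin n → ℤ) b → (∀ a → a ≢ b → f a ≡ 0ℤ) → sum f ≡ f b
  sum-single {suc n} f zero vanish = begin
    f zero + sum (f ∘ suc) ≡⟨ cong (λ t → f zero + t) (sum-cong-≗ (λ i → vanish (suc i) λ ())) ⟩
    f zero + ∑[ i < n ] 0ℤ ≡⟨ cong (λ t → f zero + t) (sum-replicate-zero n) ⟩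
    f zero + 0ℤ            ≡⟨ ℤ.+-identityʳ (f zero) ⟩
    f zero                 ∎
    where open ≡-Reasoning
  sum-single f (suc b) vanish = begin
    f zero + sum (f ∘ suc) ≡⟨ cong₂ _+_ (vanish zero λ ()) (sum-single (f ∘ suc) b (λ a a≢b → vanish (suc a) (a≢b ∘ Fin.suc-injective))) ⟩
    0ℤ + f (suc b)         ≡⟨ ℤ.+-identityˡ _ ⟩
    f (suc b)              ∎
    where open ≡-Reasoning

  prod-transpose : ∀ {n} (f : Fin n → ℤ) i j → prod (f ∘ PC.transpose i j) ≡ prod f
  prod-transpose f i j = sym (prod-permute f (Perm.transpose i j))

  prod≢0 : ∀ {n} (f : Fin n → ℤ) → (∀ i → f i ≢ 0ℤ) → prod f ≢ 0ℤ
  prod≢0 {zero}  f f≢0 ()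
  prod≢0 {suc n} f f≢0 eq with ℤ.i*j≡0⇒i≡0∨j≡0 (f zero) eq
  ... | inj₁ f0≡0 = f≢0 zero f0≡0
  ... | inj₂ rest≡0 = prod≢0 (f ∘ suc) (f≢0 ∘ suc) rest≡0

module Transposition where

  open import Data.Nat.Base using (ℕ)
  open import Data.Fin.Base using (Fin)
  open import Data.Fin.Properties using (_≟_)
  open import Data.Fin.Permutation.Components public using (transpose; transpose-inverse)
  open import Data.Vec.Functional using (Vector; updateAt)
  open import Data.Vec.Functional.Properties using (updateAt-updates; updateAt-minimal)
  open import Function.Base using (_∘_; const)
  open import Function.Definitions using (Injective)
  open import Relation.Binary.PropositionalEquality
  open import Relation.Nullary using (yes; no)
  open import Relation.Nullary.Negation using (contradiction)

  private variable
    A : Set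
    m n : ℕ

  transpose-matchˡ : (i j : Fin n) → transpose i j i ≡ j
  transpose-matchˡ i j with i ≟ i
  ... | yes _   = refl
  ... | no i≢i = contradiction refl i≢i

  transpose-matchʳ : (i j : Fin n) → transpose i j j ≡ i
  transpose-matchʳ i j with j ≟ i
  ... | yes refl = refl
  ... | no _ with j ≟ j
  ...   | yes _   = refl
  ...   | no j≢j = contradiction refl j≢j

  transpose-other : ∀ (i j : Fin n) {k} → k ≢ i → k ≢ j → transpose i j k ≡ k
  transpose-other i j {k} k≢i k≢j with k ≟ i
  ... | yes k≡i = contradiction k≡i k≢i
  ... | no _ with k ≟ j
  ...   | yes k≡j = contradiction k≡j k≢j
  ...   | no _    = refl

  data TransposeView (i j : Fin n) : Fin n → Set where
    at-i  : TransposeView i j i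
    at-j  : TransposeView i j j
    other : ∀ {k} → k ≢ i → k ≢ j → TransposeView i j k

  transposeView : (i j k : Fin n) → TransposeView i j k
  transposeView i j k with k ≟ i | k ≟ j
  ... | yes refl | _        = at-i
  ... | no _     | yes refl = at-j
  ... | no k≢i   | no k≢j   = other k≢i k≢j

  transpose-comm : (i j k : Fin n) → transpose i j k ≡ transpose j i k
  transpose-comm i j k with transposeView i j k
  ... | at-i          = trans (transpose-matchˡ i j) (sym (transpose-matchʳ j i))
  ... | at-j          = trans (transpose-matchʳ i j) (sym (transpose-matchˡ j i))
  ... | other k≢i k≢j = trans (transpose-other i j k≢i k≢j) (sym (transpose-other j i k≢j k≢i))

  transpose-involutive : (i j k : Fin n) → transpose i j (transpose i j k) ≡ k
  transpose-involutive i j k = trans (cong (transpose i j) (transpose-comm i j k)) (transpose-inverse i j)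

  transpose-injective : (i j : Fin n) → Injective _≡_ _≡_ (transpose i j)
  transpose-injective i j {k} {l} eq =
    trans (sym (transpose-involutive i j k)) (trans (cong (transpose i j) eq) (transpose-involutive i j l))

  transpose-natural : (f : Fin m → Fin n) → Injective _≡_ _≡_ f →
                      ∀ i j k → transpose (f i) (f j) (f k) ≡ f (transpose i j k)
  transpose-natural f f-inj i j k with transposeView i j k
  ... | at-i          = trans (transpose-matchˡ (f i) (f j)) (cong f (sym (transpose-matchˡ i j)))
  ... | at-j          = trans (transpose-matchʳ (f i) (f j)) (cong f (sym (transpose-matchʳ i j)))
  ... | other k≢i k≢j = trans (transpose-other (f i) (f j) (k≢i ∘ f-inj) (k≢j ∘ f-inj))
                              (cong f (sym (transpose-other i j k≢i k≢j)))

  ∘-transpose-≗ : (y : Vector A n) {i j : Fin n} → y i ≡ y j → y ∘ transpose i j ≗ y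
  ∘-transpose-≗ y {i} {j} yi≡yj k with transposeView i j k
  ... | at-i          = trans (cong y (transpose-matchˡ i j)) (sym yi≡yj)
  ... | at-j          = trans (cong y (transpose-matchʳ i j)) yi≡yj
  ... | other k≢i k≢j = cong y (transpose-other i j k≢i k≢j)

  infixl 6 _[_]≔_
  _[_]≔_ : Vector A n → Fin n → A → Vector A n
  y [ a ]≔ z = updateAt y a (const z)

  []≔-natural : (y : Vector A n) (f : Fin m → Fin n) → Injective _≡_ _≡_ f →
                ∀ a z k → (y [ f a ]≔ z) (f k) ≡ ((y ∘ f) [ a ]≔ z) k
  []≔-natural y f f-inj a z k with k ≟ a
  ... | yes refl = trans (updateAt-updates (f k) y) (sym (updateAt-updates k (y ∘ f)))
  ... | no k≢a   = trans (updateAt-minimal (f k) (f a) y (k≢a ∘ f-inj)) (sym (updateAt-minimal k a (y ∘ f) k≢a))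

  ∘-transpose-outside : (y : Vector A n) (f : Fin m → Fin n) → Injective _≡_ _≡_ f →
                        ∀ {p} → (∀ k → f k ≢ p) →
                        ∀ a k → y (transpose (f a) p (f k)) ≡ ((y ∘ f) [ a ]≔ y p) k
  ∘-transpose-outside y f f-inj {p} outside a k with k ≟ a
  ... | yes refl = trans (cong y (transpose-matchˡ (f k) p)) (sym (updateAt-updates k (y ∘ f)))
  ... | no k≢a   = trans (cong y (transpose-other (f a) p (k≢a ∘ f-inj) (outside k)))
                         (sym (updateAt-minimal k a (y ∘ f) k≢a))

module Vandermonde where

  open import Data.Nat.Base using (ℕ; zero; suc)
  open import Data.Fin.Base using (Fin; zero; suc)
  import Data.Fin.Properties as Fin
  open import Data.Integer.Base using (ℤ; 0ℤ; 1ℤ; +_; -_; _+_; _-_; _*_)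
  import Data.Integer.Properties as ℤ
  open import Data.Integer.Tactic.RingSolver using (solve-∀)
  open import Data.Sum.Base using (inj₁; inj₂)
  open import Data.Vec.Functional using (Vector; tail)
  open import Function.Base using (_∘_)
  open import Function.Definitions using (Injective)
  open import Relation.Binary.PropositionalEquality
  open import Relation.Nullary.Negation using (contradiction)
  open Sums
  open Transposition

  private variable
    n : ℕ

  vandermonde : Vector ℤ n → ℤ
  vandermonde {zero}  y = 1ℤ
  vandermonde {suc n} y = prod (λ j → y zero - y (suc j)) * vandermonde (tail y)

  vandermonde-cong : {y y′ : Vector ℤ n} → y ≗ y′ → vandermonde y ≡ vandermonde y′
  vandermonde-cong {zero}  eq = refl
  vandermonde-cong {suc n} eq =
    cong₂ _*_ (prod-cong-≗ (λ j → cong₂ _-_ (eq zero) (eq (suc j)))) (vandermonde-cong (eq ∘ suc))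

  private
    swap₀₁ : Fin (suc (suc n)) → Fin (suc (suc n))
    swap₀₁ = transpose zero (suc zero)

  vandermonde-swap₀₁ : (y : Vector ℤ (suc (suc n))) → vandermonde (y ∘ swap₀₁) ≡ - vandermonde y
  -- Both sides unfold to the two sides of exchange, since swap₀₁ computes on constructors.
  vandermonde-swap₀₁ y = exchange (y zero) (y (suc zero))
    (prod (λ k → y zero - y (suc (suc k)))) (prod (λ k → y (suc zero) - y (suc (suc k))))
    (vandermonde (tail (tail y)))
    where
    exchange : ∀ a b p q w → ((b - a) * q) * (p * w) ≡ - (((a - b) * p) * (q * w))
    exchange = solve-∀

  vandermonde-transpose-suc : (y : Vector ℤ (suc n)) (i j : Fin n) →
                              vandermonde (tail y ∘ transpose i j) ≡ - vandermonde (tail y) →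
                              vandermonde (y ∘ transpose (suc i) (suc j)) ≡ - vandermonde y
  vandermonde-transpose-suc {n} y i j alternates = begin
    vandermonde (y ∘ transpose (suc i) (suc j))
      ≡⟨ cong₂ _*_ (prod-cong-≗ λ k → cong (λ t → y zero - y t) (transpose-natural suc Fin.suc-injective i j k))
                   (vandermonde-cong (cong y ∘ transpose-natural suc Fin.suc-injective i j)) ⟩
    prod (first ∘ transpose i j) * vandermonde (tail y ∘ transpose i j)
      ≡⟨ cong₂ _*_ (prod-transpose first i j) alternates ⟩
    prod first * - vandermonde (tail y)
      ≡⟨ ℤ.neg-distribʳ-* (prod first) (vandermonde (tail y)) ⟨
    - vandermonde y ∎
    where
    open ≡-Reasoning
    first : Vector ℤ n
    first k = y zero - y (suc k)

  vandermonde-transpose : (y : Vector ℤ n) {i j : Fin n} → i ≢ j →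
                          vandermonde (y ∘ transpose i j) ≡ - vandermonde y

  -- (0, m+2) is (0, 1)-conjugate to (1, m+2), which fixes 0.
  vandermonde-transpose₀ : (y : Vector ℤ (suc n)) (j : Fin n) →
                           vandermonde (y ∘ transpose zero (suc j)) ≡ - vandermonde y
  vandermonde-transpose₀ y zero    = vandermonde-swap₀₁ y
  vandermonde-transpose₀ {suc n} y (suc m) = begin
    vandermonde (y ∘ transpose zero (suc (suc m)))
      ≡⟨ vandermonde-cong (cong y ∘ conjugate) ⟩
    vandermonde (y′ ∘ swap₀₁)
      ≡⟨ vandermonde-swap₀₁ y′ ⟩
    - vandermonde y′
      ≡⟨ cong -_ (vandermonde-transpose-suc (y ∘ swap₀₁) zero (suc m)
                   (vandermonde-transpose (tail (y ∘ swap₀₁)) {zero} {suc m} λ ())) ⟩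
    - - vandermonde (y ∘ swap₀₁)
      ≡⟨ ℤ.neg-involutive _ ⟩
    vandermonde (y ∘ swap₀₁)
      ≡⟨ vandermonde-swap₀₁ y ⟩
    - vandermonde y ∎
    where
    open ≡-Reasoning
    y′ : Vector ℤ (suc (suc n))
    y′ = y ∘ swap₀₁ ∘ transpose (suc zero) (suc (suc m))
    conjugate : ∀ k → transpose zero (suc (suc m)) k ≡ swap₀₁ (transpose (suc zero) (suc (suc m)) (swap₀₁ k))
    conjugate k = trans (cong (transpose zero (suc (suc m))) (sym (transpose-involutive zero (suc zero) k)))
                        (transpose-natural swap₀₁ (transpose-injective zero (suc zero)) (suc zero) (suc (suc m)) (swap₀₁ k))

  vandermonde-transpose y {zero}  {zero}  0≢0 = contradiction refl 0≢0
  vandermonde-transpose y {zero}  {suc j} _   = vandermonde-transpose₀ y j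
  vandermonde-transpose y {suc i} {zero}  _   =
    trans (vandermonde-cong (cong y ∘ transpose-comm (suc i) zero)) (vandermonde-transpose₀ y i)
  vandermonde-transpose y {suc i} {suc j} i≢j =
    vandermonde-transpose-suc y i j (vandermonde-transpose (tail y) (i≢j ∘ cong suc))

  private
    self≡neg⇒0 : ∀ x → x ≡ - x → x ≡ 0ℤ
    self≡neg⇒0 x x≡-x = ℤ.*-cancelˡ-≡ (+ 2) x 0ℤ (begin
      + 2 * x  ≡⟨ double x ⟩
      x + x    ≡⟨ cong (λ t → x + t) x≡-x ⟩
      x - x    ≡⟨ ℤ.+-inverseʳ x ⟩
      0ℤ       ≡⟨ ℤ.*-zeroʳ (+ 2) ⟨
      + 2 * 0ℤ ∎)
      where
      open ≡-Reasoning
      double : ∀ x → + 2 * x ≡ x + x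
      double = solve-∀

  vandermonde-repeated : (y : Vector ℤ n) {i j : Fin n} → i ≢ j → y i ≡ y j → vandermonde y ≡ 0ℤ
  vandermonde-repeated y {i} {j} i≢j yi≡yj = self≡neg⇒0 (vandermonde y)
    (trans (sym (vandermonde-cong (∘-transpose-≗ y yi≡yj))) (vandermonde-transpose y i≢j))

  vandermonde≢0 : (y : Vector ℤ n) → Injective _≡_ _≡_ y → vandermonde y ≢ 0ℤ
  vandermonde≢0 {zero}  y y-inj ()
  vandermonde≢0 {suc n} y y-inj eq with ℤ.i*j≡0⇒i≡0∨j≡0 (prod (λ j → y zero - y (suc j))) eq
  ... | inj₁ prod≡0 = prod≢0 (λ j → y zero - y (suc j)) (λ j d≡0 → 0≢suc (y-inj (ℤ.i-j≡0⇒i≡j _ _ d≡0))) prod≡0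
    where 0≢suc : ∀ {j : Fin n} → zero ≢ suc j
          0≢suc ()
  ... | inj₂ rest≡0 = vandermonde≢0 (tail y) (Fin.suc-injective ∘ y-inj) rest≡0

module Polynomial where

  open import Data.Nat.Base as ℕ using (ℕ; zero; suc; z≤n; s≤s)
  import Data.Nat.Properties as ℕ
  open import Data.Fin.Base using (Fin; zero; suc)
  import Data.Fin.Properties as Fin
  open import Data.Integer.Base using (ℤ; 0ℤ; 1ℤ; -_; _+_; _-_; _*_)
  import Data.Integer.Properties as ℤ
  open import Data.Integer.Tactic.RingSolver using (solve-∀)
  open import Data.Product.Base using (Σ-syntax; _×_; _,_)
  open import Data.Sum.Base using (inj₁; inj₂)
  open import Data.Vec.Functional using (Vector)
  open import Function.Base using (_∘_)
  open import Function.Definitions using (Injective)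
  open import Relation.Binary.PropositionalEquality
  open import Relation.Nullary.Negation using (contradiction)
  open Sums

  -- Degree ≤ d is encoded by divided differences: for d = 1 + e, every
  -- difference quotient (f z - f r) / (z - r) is a function of degree ≤ e.
  Poly≤ : ℕ → (ℤ → ℤ) → Set
  Poly≤ zero    f = ∀ z → f z ≡ f 0ℤ
  Poly≤ (suc d) f = ∀ r → Σ[ g ∈ (ℤ → ℤ) ] (Poly≤ d g × (∀ z → f z ≡ f r + (z - r) * g z))

  Poly≤-cong : ∀ d {f f′} → Poly≤ d f → f ≗ f′ → Poly≤ d f′
  Poly≤-cong zero    p eq z = trans (sym (eq z)) (trans (p z) (eq 0ℤ))
  Poly≤-cong (suc d) p eq r with p r
  ... | g , pg , expand = g , pg , λ z →
    trans (sym (eq z)) (trans (expand z) (cong (λ t → t + (z - r) * g z) (eq r)))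

  Poly≤-const : ∀ d c → Poly≤ d (λ _ → c)
  Poly≤-const zero    c z = refl
  Poly≤-const (suc d) c r = (λ _ → 0ℤ) , Poly≤-const d 0ℤ , λ z → sym (trans
    (cong (λ t → c + t) (ℤ.*-zeroʳ (z - r))) (ℤ.+-identityʳ c))

  Poly≤-suc : ∀ d {f} → Poly≤ d f → Poly≤ (suc d) f
  Poly≤-suc zero {f} p r = (λ _ → 0ℤ) , (λ z → refl) , λ z → begin
    f z                   ≡⟨ trans (p z) (sym (p r)) ⟩
    f r                   ≡⟨ ℤ.+-identityʳ (f r) ⟨
    f r + 0ℤ              ≡⟨ cong (λ t → f r + t) (ℤ.*-zeroʳ (z - r)) ⟨
    f r + (z - r) * 0ℤ    ∎
    where open ≡-Reasoning
  Poly≤-suc (suc d) p r with p r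
  ... | g , pg , expand = g , Poly≤-suc d pg , expand

  Poly≤-mono : ∀ {d e} → d ℕ.≤ e → ∀ {f} → Poly≤ d f → Poly≤ e f
  Poly≤-mono {zero}  {zero}  z≤n p = p
  Poly≤-mono {zero}  {suc e} z≤n p = Poly≤-suc e (Poly≤-mono {zero} {e} z≤n p)
  Poly≤-mono {suc d} {suc e} (s≤s d≤e) p r with p r
  ... | g , pg , expand = g , Poly≤-mono d≤e pg , expand

  Poly≤-+ : ∀ d {f g} → Poly≤ d f → Poly≤ d g → Poly≤ d (λ z → f z + g z)
  Poly≤-+ zero    pf pg z = cong₂ _+_ (pf z) (pg z)
  Poly≤-+ (suc d) {f} {g} pf pg r with pf r | pg r
  ... | f′ , pf′ , expandf | g′ , pg′ , expandg = (λ z → f′ z + g′ z) , Poly≤-+ d pf′ pg′ , λ z →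
    trans (cong₂ _+_ (expandf z) (expandg z)) (regroup (f r) (g r) (z - r) (f′ z) (g′ z))
    where regroup : ∀ a b c x y → a + c * x + (b + c * y) ≡ a + b + c * (x + y)
          regroup = solve-∀

  Poly≤-scale : ∀ d k {f} → Poly≤ d f → Poly≤ d (λ z → k * f z)
  Poly≤-scale zero    k pf z = cong (k *_) (pf z)
  Poly≤-scale (suc d) k {f} pf r with pf r
  ... | f′ , pf′ , expand = (λ z → k * f′ z) , Poly≤-scale d k pf′ , λ z →
    trans (cong (k *_) (expand z)) (distribute k (f r) (z - r) (f′ z))
    where distribute : ∀ k a c x → k * (a + c * x) ≡ k * a + c * (k * x)
          distribute = solve-∀

  Poly≤-scaleʳ : ∀ d k {f} → Poly≤ d f → Poly≤ d (λ z → f z * k)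
  Poly≤-scaleʳ d k {f} p = Poly≤-cong d (Poly≤-scale d k p) (λ z → ℤ.*-comm k (f z))

  Poly≤-* : ∀ d e {f g} → Poly≤ d f → Poly≤ e g → Poly≤ (d ℕ.+ e) (λ z → f z * g z)
  Poly≤-* zero e {f} {g} pf pg =
    Poly≤-cong e (Poly≤-scale e (f 0ℤ) pg) (λ z → cong (_* g z) (sym (pf z)))
  Poly≤-* (suc d) zero {f} {g} pf pg =
    Poly≤-mono (ℕ.≤-reflexive (sym (ℕ.+-identityʳ (suc d))))
      (Poly≤-cong (suc d) (Poly≤-scaleʳ (suc d) (g 0ℤ) pf) (λ z → cong (f z *_) (sym (pg z))))
  Poly≤-* (suc d) (suc e) {f} {g} pf pg r with pf r | pg r
  ... | f′ , pf′ , expandf | g′ , pg′ , expandg =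
    (λ z → f′ z * g z + f r * g′ z) ,
    Poly≤-+ (d ℕ.+ suc e) (Poly≤-* d (suc e) pf′ pg) (Poly≤-mono (ℕ.m≤n+m (suc e) d) (Poly≤-suc e (Poly≤-scale e (f r) pg′))) ,
    λ z → begin
      f z * g z
        ≡⟨ cong₂ _*_ (expandf z) (expandg z) ⟩
      (f r + (z - r) * f′ z) * (g r + (z - r) * g′ z)
        ≡⟨ expand (f r) (g r) (z - r) (f′ z) (g′ z) ⟩
      f r * g r + (z - r) * (f′ z * (g r + (z - r) * g′ z) + f r * g′ z)
        ≡⟨ cong (λ t → f r * g r + (z - r) * (f′ z * t + f r * g′ z)) (expandg z) ⟨
      f r * g r + (z - r) * (f′ z * g z + f r * g′ z) ∎
    where
    open ≡-Reasoning
    expand : ∀ a b c x y → (a + c * x) * (b + c * y) ≡ a * b + c * (x * (b + c * y) + a * y)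
    expand = solve-∀

  Poly≤-sum : ∀ d {n} (fs : Fin n → ℤ → ℤ) → (∀ a → Poly≤ d (fs a)) → Poly≤ d (λ z → ∑[ a < n ] fs a z)
  Poly≤-sum d {zero}  fs p = Poly≤-const d 0ℤ
  Poly≤-sum d {suc n} fs p = Poly≤-+ d (p zero) (Poly≤-sum d (fs ∘ suc) (p ∘ suc))

  Poly≤-linear : ∀ a → Poly≤ 1 (λ z → z - a)
  Poly≤-linear a r = (λ _ → 1ℤ) , (λ z → refl) , λ z → shift z r a
    where shift : ∀ z r a → z - a ≡ r - a + (z - r) * 1ℤ
          shift = solve-∀

  Poly≤-linear′ : ∀ a → Poly≤ 1 (λ z → a - z)
  Poly≤-linear′ a r = (λ _ → - 1ℤ) , (λ z → refl) , λ z → shift z r a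
    where shift : ∀ z r a → a - z ≡ a - r + (z - r) * - 1ℤ
          shift = solve-∀

  Poly≤-roots : ∀ d {f} → Poly≤ d f → (r : Vector ℤ (suc d)) → Injective _≡_ _≡_ r →
                (∀ i → f (r i) ≡ 0ℤ) → ∀ z → f z ≡ 0ℤ
  Poly≤-roots zero    pf r r-inj roots z = trans (pf z) (trans (sym (pf (r zero))) (roots zero))
  Poly≤-roots (suc d) {f} pf r r-inj roots z with pf (r zero)
  ... | g , pg , expand = begin
    f z                       ≡⟨ expand z ⟩
    f (r zero) + (z - r zero) * g z ≡⟨ cong₂ (λ a b → a + (z - r zero) * b) (roots zero) (g-vanishes z) ⟩
    0ℤ + (z - r zero) * 0ℤ    ≡⟨ cong (0ℤ +_) (ℤ.*-zeroʳ (z - r zero)) ⟩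
    0ℤ                        ∎
    where
    open ≡-Reasoning
    g-roots : ∀ i → g (r (suc i)) ≡ 0ℤ
    g-roots i with ℤ.i*j≡0⇒i≡0∨j≡0 (r (suc i) - r zero) (begin
      (r (suc i) - r zero) * g (r (suc i))         ≡⟨ ℤ.+-identityˡ _ ⟨
      0ℤ + (r (suc i) - r zero) * g (r (suc i))   ≡⟨ cong (λ t → t + (r (suc i) - r zero) * g (r (suc i))) (roots zero) ⟨
      f (r zero) + (r (suc i) - r zero) * g (r (suc i)) ≡⟨ expand (r (suc i)) ⟨
      f (r (suc i))                               ≡⟨ roots (suc i) ⟩
      0ℤ                                          ∎)
    ... | inj₁ diff≡0 = contradiction (r-inj (ℤ.i-j≡0⇒i≡j _ _ diff≡0)) λ ()
    ... | inj₂ g≡0    = g≡0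
    g-vanishes : ∀ z → g z ≡ 0ℤ
    g-vanishes = Poly≤-roots d pg (r ∘ suc) (Fin.suc-injective ∘ r-inj) g-roots

module Interpolation where

  open import Data.Nat.Base using (ℕ; zero; suc)
  open import Data.Fin.Base using (Fin; zero; suc)
  open import Data.Integer.Base using (ℤ; 0ℤ; 1ℤ; -_; _-_; _*_)
  import Data.Integer.Properties as ℤ
  open import Data.Vec.Functional using (Vector; tail)
  open import Data.Vec.Functional.Properties using (updateAt-updates; updateAt-minimal; updateAt-id-local)
  open import Function.Base using (_∘_)
  open import Function.Definitions using (Injective)
  open import Relation.Binary.PropositionalEquality
  open Sums
  open Transposition
  open Vandermonde
  open Polynomial

  private variable
    m : ℕ

  prod-update-Poly≤ : (c : ℤ) (w : Vector ℤ m) (a : Fin m) → Poly≤ 1 (λ z → prod (λ j → c - (w [ a ]≔ z) j))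
  prod-update-Poly≤ c w zero    = Poly≤-* 1 0 (Poly≤-linear′ c) (Poly≤-const 0 (prod (λ j → c - w (suc j))))
  prod-update-Poly≤ c w (suc a) = Poly≤-* 0 1 (Poly≤-const 0 (c - w zero)) (prod-update-Poly≤ c (tail w) a)

  prod-linear-Poly≤ : (w : Vector ℤ m) → Poly≤ m (λ z → prod (λ j → z - w j))
  prod-linear-Poly≤ {zero}  w = Poly≤-const 0 1ℤ
  prod-linear-Poly≤ {suc m} w = Poly≤-* 1 m (Poly≤-linear (w zero)) (prod-linear-Poly≤ (tail w))

  vandermonde-update-Poly≤ : ∀ d (y : Vector ℤ (suc d)) a → Poly≤ d (λ z → vandermonde (y [ a ]≔ z))
  vandermonde-update-Poly≤ d       y zero    = Poly≤-scaleʳ d (vandermonde (tail y)) (prod-linear-Poly≤ (tail y))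
  vandermonde-update-Poly≤ (suc d) y (suc a) =
    Poly≤-* 1 d (prod-update-Poly≤ (y zero) (tail y) a) (vandermonde-update-Poly≤ d (tail y) a)

  -- Both sides are polynomials of degree ≤ d in z that agree at the d + 1 points y b.
  vandermonde-interpolation : ∀ d (y : Vector ℤ (suc d)) → Injective _≡_ _≡_ y →
                              ∀ P → Poly≤ d P → ∀ z →
                              ∑[ a < suc d ] (vandermonde (y [ a ]≔ z) * P (y a)) ≡ vandermonde y * P z
  vandermonde-interpolation d y y-inj P pP z = ℤ.i-j≡0⇒i≡j _ _ (Poly≤-roots d difference-Poly≤ y y-inj agree z)
    where
    S : ℤ → ℤ
    S z = ∑[ a < suc d ] (vandermonde (y [ a ]≔ z) * P (y a))
    difference-Poly≤ : Poly≤ d (λ z → S z - vandermonde y * P z)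
    difference-Poly≤ = Poly≤-+ d
      (Poly≤-sum d _ λ a → Poly≤-scaleʳ d (P (y a)) (vandermonde-update-Poly≤ d y a))
      (Poly≤-cong d (Poly≤-scale d (- vandermonde y) pP) λ z → sym (ℤ.neg-distribˡ-* (vandermonde y) (P z)))
    agree : ∀ b → S (y b) - vandermonde y * P (y b) ≡ 0ℤ
    agree b = ℤ.i≡j⇒i-j≡0 (begin
      S (y b)
        ≡⟨ sum-single _ b (λ a a≢b → cong (_* P (y a)) (vandermonde-repeated (y [ a ]≔ y b) a≢b (repeated a a≢b))) ⟩
      vandermonde (y [ b ]≔ y b) * P (y b)
        ≡⟨ cong (_* P (y b)) (vandermonde-cong (updateAt-id-local b y refl)) ⟩
      vandermonde y * P (y b) ∎)
      where
      open ≡-Reasoning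
      repeated : ∀ a → a ≢ b → (y [ a ]≔ y b) a ≡ (y [ a ]≔ y b) b
      repeated a a≢b = trans (updateAt-updates a y) (sym (updateAt-minimal b a y (a≢b ∘ sym)))

module Choose2 where

  open import Data.Nat.Base using (ℕ; zero; suc; _+_; _*_)
  import Data.Nat.Properties as ℕ
  open import Data.Nat.Combinatorics using (_C_; nCk+nC[k+1]≡[n+1]C[k+1]; nC1≡n)
  open import Data.Nat.Tactic.RingSolver using (solve-∀)
  open import Relation.Binary.PropositionalEquality

  C₂ : ℕ → ℕ
  C₂ zero    = 0
  C₂ (suc n) = n + C₂ n

  C≡C₂ : ∀ m → m C 2 ≡ C₂ m
  C≡C₂ zero    = refl
  C≡C₂ (suc m) = trans (sym (nCk+nC[k+1]≡[n+1]C[k+1] m 1)) (cong₂ _+_ (nC1≡n m) (C≡C₂ m))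

  C₂-+ : ∀ a b → C₂ (a + b) ≡ C₂ a + C₂ b + a * b
  C₂-+ zero    b = sym (ℕ.+-identityʳ (C₂ b))
  C₂-+ (suc a) b = trans (cong (λ t → a + b + t) (C₂-+ a b)) (regroup a b (C₂ a) (C₂ b))
    where regroup : ∀ a b x y → a + b + (x + y + a * b) ≡ a + x + y + suc a * b
          regroup = solve-∀

  C₂-double : ∀ m → C₂ m + C₂ m + m ≡ m * m
  C₂-double zero    = refl
  C₂-double (suc m) = begin
    m + C₂ m + (m + C₂ m) + suc m  ≡⟨ regroup m (C₂ m) ⟩
    suc (m + m + (C₂ m + C₂ m + m)) ≡⟨ cong (λ t → suc (m + m + t)) (C₂-double m) ⟩
    suc (m + m + m * m)            ≡⟨ square m ⟩
    suc m * suc m                  ∎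
    where
    open ≡-Reasoning
    regroup : ∀ m c → m + c + (m + c) + suc m ≡ suc (m + m + (c + c + m))
    regroup = solve-∀
    square : ∀ m → suc (m + m + m * m) ≡ suc m * suc m
    square = solve-∀

  C₂-suc-+ : ∀ b e → C₂ (suc (b + e)) ≡ C₂ (suc b) + b * e + C₂ (suc e)
  C₂-suc-+ b e = trans (C₂-+ (suc b) e) (regroup b e (C₂ b) (C₂ e))
    where regroup : ∀ b e x y → b + x + y + suc b * e ≡ b + x + b * e + (e + y)
          regroup = solve-∀

  C₂-consecutive : ∀ δ → C₂ (suc δ) + C₂ (suc (suc δ)) ≡ suc δ * suc δ
  C₂-consecutive δ = trans (regroup (C₂ (suc δ)) δ) (C₂-double (suc δ))
    where regroup : ∀ t δ → t + (suc δ + t) ≡ t + t + suc δ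
          regroup = solve-∀

module YoungDiagram where

  open import Data.Nat.Base using (ℕ; zero; suc; _+_; _*_; _≤_)
  open import Data.Nat.Tactic.RingSolver using () renaming (solve-∀ to ℕ-solve)
  open import Data.Integer.Base using (ℤ; 0ℤ; +_) renaming (_+_ to _+ℤ_; _-_ to _-ℤ_)
  import Data.Integer.Properties as ℤ
  open import Data.Integer.Tactic.RingSolver using (solve-∀)
  open import Data.List.Base using (List; []; _∷_; _++_; map; replicate; length)
  open import Data.List.Relation.Unary.All using (All)
  open import Data.Nat.ListAction using (sum)
  open import Data.Nat.ListAction.Properties using (sum-++)
  open import Data.Product.Base using (_×_)
  open import Data.Unit.Base using (⊤)
  open import Relation.Binary.PropositionalEquality
  open Choose2 using (C₂)

  -- A list of column lengths, longest first.
  IsPartition : List ℕ → Set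
  IsPartition []       = ⊤
  IsPartition (c ∷ cs) = 1 ≤ c × All (_≤ c) cs × IsPartition cs

  -- The sum over all cells of (column index − row index): prepending a
  -- column shifts every other cell one column to the right.
  content : List ℕ → ℤ
  content []       = 0ℤ
  content (c ∷ cs) = content cs +ℤ + sum cs -ℤ + C₂ c

  sum-map-suc : ∀ cs → sum (map suc cs) ≡ sum cs + length cs
  sum-map-suc []       = refl
  sum-map-suc (c ∷ cs) = trans (cong (λ t → suc (c + t)) (sum-map-suc cs)) (regroup c (sum cs) (length cs))
    where regroup : ∀ c s l → suc (c + (s + l)) ≡ c + s + suc l
          regroup = ℕ-solve

  sum-replicate-1 : ∀ r → sum (replicate r 1) ≡ r
  sum-replicate-1 zero    = refl
  sum-replicate-1 (suc r) = cong suc (sum-replicate-1 r)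

  content-++ : ∀ xs ys → content (xs ++ ys) ≡ content xs +ℤ content ys +ℤ + (length xs * sum ys)
  content-++ []       ys = sym (trans (ℤ.+-identityʳ (0ℤ +ℤ content ys)) (ℤ.+-identityˡ (content ys)))
  content-++ (x ∷ xs) ys = begin
    content (xs ++ ys) +ℤ + sum (xs ++ ys) -ℤ + C₂ x
      ≡⟨ cong₂ (λ c s → c +ℤ + s -ℤ + C₂ x) (content-++ xs ys) (sum-++ xs ys) ⟩
    content xs +ℤ content ys +ℤ + (length xs * sum ys) +ℤ + (sum xs + sum ys) -ℤ + C₂ x
      ≡⟨ cong (λ t → content xs +ℤ content ys +ℤ + (length xs * sum ys) +ℤ t -ℤ + C₂ x) (ℤ.pos-+ (sum xs) (sum ys)) ⟩
    content xs +ℤ content ys +ℤ + (length xs * sum ys) +ℤ (+ sum xs +ℤ + sum ys) -ℤ + C₂ x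
      ≡⟨ regroup (content xs) (content ys) (+ (length xs * sum ys)) (+ sum xs) (+ sum ys) (+ C₂ x) ⟩
    content xs +ℤ + sum xs -ℤ + C₂ x +ℤ content ys +ℤ (+ sum ys +ℤ + (length xs * sum ys))
      ≡⟨ cong (λ t → content (x ∷ xs) +ℤ content ys +ℤ t) (ℤ.pos-+ (sum ys) (length xs * sum ys)) ⟨
    content (x ∷ xs) +ℤ content ys +ℤ + (length (x ∷ xs) * sum ys) ∎
    where
    open ≡-Reasoning
    regroup : ∀ a b c d e f → a +ℤ b +ℤ c +ℤ (d +ℤ e) -ℤ f ≡ a +ℤ d -ℤ f +ℤ b +ℤ (e +ℤ c)
    regroup = solve-∀

  content-map-suc : ∀ cs → content (map suc cs) ≡ content cs +ℤ + C₂ (length cs) -ℤ + sum cs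
  content-map-suc []       = refl
  content-map-suc (c ∷ cs) = begin
    content (map suc cs) +ℤ + sum (map suc cs) -ℤ + C₂ (suc c)
      ≡⟨ cong₂ (λ e s → e +ℤ + s -ℤ + C₂ (suc c)) (content-map-suc cs) (sum-map-suc cs) ⟩
    content cs +ℤ + C₂ l -ℤ + s +ℤ + (s + l) -ℤ + (c + C₂ c)
      ≡⟨ cong₂ (λ x y → content cs +ℤ + C₂ l -ℤ + s +ℤ x -ℤ y) (ℤ.pos-+ s l) (ℤ.pos-+ c (C₂ c)) ⟩
    content cs +ℤ + C₂ l -ℤ + s +ℤ (+ s +ℤ + l) -ℤ (+ c +ℤ + C₂ c)
      ≡⟨ regroup (content cs) (+ C₂ l) (+ s) (+ l) (+ c) (+ C₂ c) ⟩
    content cs +ℤ + s -ℤ + C₂ c +ℤ (+ l +ℤ + C₂ l) -ℤ (+ c +ℤ + s)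
      ≡⟨ cong₂ (λ x y → content (c ∷ cs) +ℤ x -ℤ y) (ℤ.pos-+ l (C₂ l)) (ℤ.pos-+ c s) ⟨
    content (c ∷ cs) +ℤ + C₂ (length (c ∷ cs)) -ℤ + sum (c ∷ cs) ∎
    where
    open ≡-Reasoning
    l s : ℕ
    l = length cs
    s = sum cs
    regroup : ∀ e l s n c d → e +ℤ l -ℤ s +ℤ (s +ℤ n) -ℤ (c +ℤ d) ≡ e +ℤ s -ℤ d +ℤ (n +ℤ l) -ℤ (c +ℤ s)
    regroup = solve-∀

  content-replicate-1 : ∀ r → content (replicate r 1) ≡ + C₂ r
  content-replicate-1 zero    = refl
  content-replicate-1 (suc r) = begin
    content (replicate r 1) +ℤ + sum (replicate r 1) -ℤ 0ℤ
      ≡⟨ ℤ.+-identityʳ _ ⟩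
    content (replicate r 1) +ℤ + sum (replicate r 1)
      ≡⟨ cong₂ (λ e s → e +ℤ + s) (content-replicate-1 r) (sum-replicate-1 r) ⟩
    + C₂ r +ℤ + r
      ≡⟨ ℤ.+-comm (+ C₂ r) (+ r) ⟩
    + (r + C₂ r) ∎
    where open ≡-Reasoning

module Eigenvector where

  open import Data.Nat.Base as ℕ using (ℕ; zero; suc; _≤_; s≤s; _<ᵇ_)
  import Data.Nat.Properties as ℕ
  open import Data.Fin.Base using (Fin; zero; suc; toℕ; _↑ˡ_; _↑ʳ_)
  import Data.Fin.Properties as Fin
  open import Data.Fin.Permutation as Perm using (_⟨$⟩ˡ_; _⟨$⟩ʳ_; _∘ₚ_)
  open import Data.Integer.Base using (ℤ; 0ℤ; 1ℤ; +_; -_; _+_; _-_; _*_)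
  import Data.Integer.Properties as ℤ
  open import Data.Integer.Tactic.RingSolver using (solve-∀)
  open import Data.Bool.Base using (if_then_else_)
  open import Data.List.Base as List using (List; []; _∷_; tabulate; foldr)
  import Data.List.Properties as List
  open import Data.List.Relation.Unary.All using (All; []; _∷_)
  open import Data.Nat.ListAction using (sum)
  open import Data.Product.Base using (_,_)
  open import Data.Sum.Base using (inj₁; inj₂)
  open import Data.Vec.Functional using (Vector)
  open import Data.Vec.Functional.Properties using (updateAt-minimal; updateAt-id-local)
  open import Function.Base using (_∘_; id)
  open import Function.Definitions using (Injective)
  open import Relation.Binary.PropositionalEquality
  open import Defs using (Sym; Σℤ; Respects≈; adjApply; IsTranspositionGraphEigenvalue)
  open Sums using (sum-syntax; sum-cong-≗; sum-const; sum-↑; ∑-comm; *-distribˡ-sum)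
  open Transposition
  open Vandermonde
  open Polynomial
  open Interpolation
  open Choose2
  open YoungDiagram

  private variable
    n : ℕ

  pairSum : (Fin n → Fin n → ℤ) → ℤ
  pairSum {zero}  h = 0ℤ
  pairSum {suc n} h = ∑[ j < n ] h zero (suc j) + pairSum (λ i j → h (suc i) (suc j))

  pairSum-cong : {h h′ : Fin n → Fin n → ℤ} → (∀ i j → i ≢ j → h i j ≡ h′ i j) → pairSum h ≡ pairSum h′
  pairSum-cong {zero}  eq = refl
  pairSum-cong {suc n} eq = cong₂ _+_ (sum-cong-≗ λ j → eq zero (suc j) λ ())
                                      (pairSum-cong λ i j i≢j → eq (suc i) (suc j) (i≢j ∘ Fin.suc-injective))

  pairSum-const : ∀ n k → pairSum {n} (λ _ _ → k) ≡ + C₂ n * k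
  pairSum-const zero    k = sym (ℤ.*-zeroˡ k)
  pairSum-const (suc n) k = begin
    ∑[ j < n ] k + pairSum {n} (λ _ _ → k) ≡⟨ cong₂ _+_ (sum-const n k) (pairSum-const n k) ⟩
    + n * k + + C₂ n * k                   ≡⟨ ℤ.*-distribʳ-+ k (+ n) (+ C₂ n) ⟨
    + C₂ (suc n) * k                       ∎
    where open ≡-Reasoning

  pairSum-scale : ∀ k (h : Fin n → Fin n → ℤ) → pairSum (λ i j → k * h i j) ≡ k * pairSum h
  pairSum-scale {zero}  k h = sym (ℤ.*-zeroʳ k)
  pairSum-scale {suc n} k h = begin
    ∑[ j < n ] (k * h zero (suc j)) + pairSum (λ i j → k * h (suc i) (suc j))
      ≡⟨ cong₂ _+_ (sym (*-distribˡ-sum k (h zero ∘ suc))) (pairSum-scale k (λ i j → h (suc i) (suc j))) ⟩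
    k * ∑[ j < n ] h zero (suc j) + k * pairSum (λ i j → h (suc i) (suc j))
      ≡⟨ ℤ.*-distribˡ-+ k _ _ ⟨
    k * pairSum h ∎
    where open ≡-Reasoning

  pairSum-↑ : ∀ a b (h : Fin (a ℕ.+ b) → Fin (a ℕ.+ b) → ℤ) →
              pairSum h ≡ pairSum (λ i j → h (i ↑ˡ b) (j ↑ˡ b))
                        + ∑[ i < a ] ∑[ j < b ] h (i ↑ˡ b) (a ↑ʳ j)
                        + pairSum (λ i j → h (a ↑ʳ i) (a ↑ʳ j))
  pairSum-↑ zero    b h = sym (trans (cong (_+ pairSum h) (ℤ.+-identityˡ 0ℤ)) (ℤ.+-identityˡ _))
  pairSum-↑ (suc a) b h = begin
    ∑[ j < a ℕ.+ b ] h zero (suc j) + pairSum h′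
      ≡⟨ cong₂ _+_ (sum-↑ a b (h zero ∘ suc)) (pairSum-↑ a b h′) ⟩
    (p + q) + (r + s + t)
      ≡⟨ regroup p q r s t ⟩
    (p + r) + (q + s) + t ∎
    where
    open ≡-Reasoning
    h′ : Fin (a ℕ.+ b) → Fin (a ℕ.+ b) → ℤ
    h′ i j = h (suc i) (suc j)
    p q r s t : ℤ
    p = ∑[ j < a ] h zero (suc (j ↑ˡ b))
    q = ∑[ j < b ] h zero (suc (a ↑ʳ j))
    r = pairSum (λ i j → h′ (i ↑ˡ b) (j ↑ˡ b))
    s = ∑[ i < a ] ∑[ j < b ] h′ (i ↑ˡ b) (a ↑ʳ j)
    t = pairSum (λ i j → h′ (a ↑ʳ i) (a ↑ʳ j))
    regroup : ∀ p q r s t → (p + q) + (r + s + t) ≡ (p + r) + (q + s) + t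
    regroup = solve-∀

  data SplitView a b : Fin (a ℕ.+ b) → Set where
    left  : (i : Fin a) → SplitView a b (i ↑ˡ b)
    right : (j : Fin b) → SplitView a b (a ↑ʳ j)

  splitView : ∀ a b (k : Fin (a ℕ.+ b)) → SplitView a b k
  splitView zero    b k       = right k
  splitView (suc a) b zero    = left zero
  splitView (suc a) b (suc k) with splitView a b k
  ... | left i  = left (suc i)
  ... | right j = right j

  ↑ˡ≢↑ʳ : ∀ a b (i : Fin a) (j : Fin b) → i ↑ˡ b ≢ a ↑ʳ j
  ↑ˡ≢↑ʳ (suc a) b zero    j ()
  ↑ˡ≢↑ʳ (suc a) b (suc i) j eq = ↑ˡ≢↑ʳ a b i j (Fin.suc-injective eq)

  ↑ˡ-inj : ∀ {a} b → Injective _≡_ _≡_ (λ (i : Fin a) → i ↑ˡ b)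
  ↑ˡ-inj b = Fin.↑ˡ-injective b _ _

  ↑ʳ-inj : ∀ a {b} → Injective _≡_ _≡_ (λ (j : Fin b) → a ↑ʳ j)
  ↑ʳ-inj a = Fin.↑ʳ-injective a _ _

  -- The Specht polynomial of the tableau filled column by column.
  columnProduct : (cs : List ℕ) → Vector ℤ (sum cs) → ℤ
  columnProduct []       x = 1ℤ
  columnProduct (c ∷ cs) x = vandermonde (x ∘ (_↑ˡ sum cs)) * columnProduct cs (x ∘ (c ↑ʳ_))

  columnProduct-cong : ∀ cs {x x′ : Vector ℤ (sum cs)} → x ≗ x′ → columnProduct cs x ≡ columnProduct cs x′
  columnProduct-cong []       eq = refl
  columnProduct-cong (c ∷ cs) eq = cong₂ _*_ (vandermonde-cong (eq ∘ (_↑ˡ sum cs))) (columnProduct-cong cs (eq ∘ (c ↑ʳ_)))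

  columnProduct≢0 : ∀ cs (x : Vector ℤ (sum cs)) → Injective _≡_ _≡_ x → columnProduct cs x ≢ 0ℤ
  columnProduct≢0 []       x x-inj ()
  columnProduct≢0 (c ∷ cs) x x-inj eq with ℤ.i*j≡0⇒i≡0∨j≡0 (vandermonde (x ∘ (_↑ˡ sum cs))) eq
  ... | inj₁ V≡0 = vandermonde≢0 _ (↑ˡ-inj (sum cs) ∘ x-inj) V≡0
  ... | inj₂ F≡0 = columnProduct≢0 cs _ (↑ʳ-inj c ∘ x-inj) F≡0

  columnProduct-update-Poly≤ : ∀ d cs → All (_≤ suc d) cs → ∀ (x : Vector ℤ (sum cs)) j →
                               Poly≤ d (λ w → columnProduct cs (x [ j ]≔ w))
  columnProduct-update-Poly≤ d []       []               x j = Poly≤-const d 1ℤ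
  columnProduct-update-Poly≤ d (c ∷ cs) (c≤1+d ∷ cs≤1+d) x j with splitView c (sum cs) j
  columnProduct-update-Poly≤ d (suc c ∷ cs) (s≤s c≤d ∷ _) x j | left i =
    Poly≤-cong d (Poly≤-scaleʳ d (columnProduct cs (x ∘ (suc c ↑ʳ_))) (Poly≤-mono c≤d (vandermonde-update-Poly≤ c (x ∘ (_↑ˡ sum cs)) i)))
      λ w → cong₂ _*_ (vandermonde-cong (sym ∘ []≔-natural x (_↑ˡ sum cs) (↑ˡ-inj (sum cs)) i w))
                      (columnProduct-cong cs λ k → sym (updateAt-minimal (suc c ↑ʳ k) (i ↑ˡ sum cs) x (↑ˡ≢↑ʳ _ _ i k ∘ sym)))
  ... | right i =
    Poly≤-cong d (Poly≤-scale d (vandermonde (x ∘ (_↑ˡ sum cs))) (columnProduct-update-Poly≤ d cs cs≤1+d (x ∘ (c ↑ʳ_)) i))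
      λ w → cong₂ _*_ (vandermonde-cong λ k → sym (updateAt-minimal (k ↑ˡ sum cs) (c ↑ʳ i) x (↑ˡ≢↑ʳ _ _ k i)))
                      (columnProduct-cong cs (sym ∘ []≔-natural x (c ↑ʳ_) (↑ʳ-inj c) i w))

  module _ (c : ℕ) (cs : List ℕ) (x : Vector ℤ (c ℕ.+ sum cs)) where

    private
      y : Vector ℤ c
      y = x ∘ (_↑ˡ sum cs)
      ys : Vector ℤ (sum cs)
      ys = x ∘ (c ↑ʳ_)
      swapped : Fin (c ℕ.+ sum cs) → Fin (c ℕ.+ sum cs) → ℤ
      swapped i j = columnProduct (c ∷ cs) (x ∘ transpose i j)

    swaps-within-first-column :
      pairSum (λ i j → swapped (i ↑ˡ sum cs) (j ↑ˡ sum cs)) ≡ + C₂ c * - columnProduct (c ∷ cs) x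
    swaps-within-first-column = trans (pairSum-cong λ i j i≢j → begin
        vandermonde (x ∘ transpose (i ↑ˡ sum cs) (j ↑ˡ sum cs) ∘ (_↑ˡ sum cs))
          * columnProduct cs (x ∘ transpose (i ↑ˡ sum cs) (j ↑ˡ sum cs) ∘ (c ↑ʳ_))
          ≡⟨ cong₂ _*_ (vandermonde-cong (cong x ∘ transpose-natural (_↑ˡ sum cs) (↑ˡ-inj (sum cs)) i j))
                       (columnProduct-cong cs λ k → cong x (transpose-other _ _ (↑ˡ≢↑ʳ _ _ i k ∘ sym) (↑ˡ≢↑ʳ _ _ j k ∘ sym))) ⟩
        vandermonde (y ∘ transpose i j) * columnProduct cs ys
          ≡⟨ cong (_* columnProduct cs ys) (vandermonde-transpose y i≢j) ⟩
        - vandermonde y * columnProduct cs ys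
          ≡⟨ ℤ.neg-distribˡ-* (vandermonde y) (columnProduct cs ys) ⟨
        - columnProduct (c ∷ cs) x ∎)
      (pairSum-const c _)
      where open ≡-Reasoning

    swaps-within-other-columns :
      pairSum (λ i j → swapped (c ↑ʳ i) (c ↑ʳ j)) ≡ vandermonde y * pairSum (λ i j → columnProduct cs (ys ∘ transpose i j))
    swaps-within-other-columns = trans (pairSum-cong λ i j _ → cong₂ _*_
        (vandermonde-cong λ k → cong x (transpose-other _ _ (↑ˡ≢↑ʳ _ _ k i) (↑ˡ≢↑ʳ _ _ k j)))
        (columnProduct-cong cs (cong x ∘ transpose-natural (c ↑ʳ_) (↑ʳ-inj c) i j)))
      (pairSum-scale (vandermonde y) (λ i j → columnProduct cs (ys ∘ transpose i j)))

    -- Summed over the first column, the swaps with a fixed later cell are a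
    -- Lagrange interpolation of the remaining factor, which has degree < c in that cell.
    swaps-across-first-column : ∀ d → c ≡ suc d → All (_≤ c) cs → Injective _≡_ _≡_ x →
      ∑[ i < c ] ∑[ j < sum cs ] swapped (i ↑ˡ sum cs) (c ↑ʳ j) ≡ + sum cs * columnProduct (c ∷ cs) x
    swaps-across-first-column d refl cs≤c x-inj = begin
      ∑[ i < c ] ∑[ j < sum cs ] swapped (i ↑ˡ sum cs) (c ↑ʳ j)
        ≡⟨ sum-cong-≗ (λ i → sum-cong-≗ λ j → cong₂ _*_
             (vandermonde-cong (∘-transpose-outside x (_↑ˡ sum cs) (↑ˡ-inj (sum cs)) (λ k → ↑ˡ≢↑ʳ _ _ k j) i))
             (columnProduct-cong cs λ k → trans (cong x (transpose-comm (i ↑ˡ sum cs) (c ↑ʳ j) (c ↑ʳ k)))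
                (∘-transpose-outside x (c ↑ʳ_) (↑ʳ-inj c) (λ k → ↑ˡ≢↑ʳ _ _ i k ∘ sym) j k))) ⟩
      ∑[ i < c ] ∑[ j < sum cs ] (vandermonde (y [ i ]≔ ys j) * columnProduct cs (ys [ j ]≔ y i))
        ≡⟨ ∑-comm (λ i j → vandermonde (y [ i ]≔ ys j) * columnProduct cs (ys [ j ]≔ y i)) ⟩
      ∑[ j < sum cs ] ∑[ i < c ] (vandermonde (y [ i ]≔ ys j) * columnProduct cs (ys [ j ]≔ y i))
        ≡⟨ sum-cong-≗ (λ j → vandermonde-interpolation d y (↑ˡ-inj (sum cs) ∘ x-inj) _
                               (columnProduct-update-Poly≤ d cs cs≤c ys j) (ys j)) ⟩
      ∑[ j < sum cs ] (vandermonde y * columnProduct cs (ys [ j ]≔ ys j))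
        ≡⟨ sum-cong-≗ (λ j → cong (vandermonde y *_) (columnProduct-cong cs (updateAt-id-local j ys refl))) ⟩
      ∑[ j < sum cs ] (vandermonde y * columnProduct cs ys)
        ≡⟨ sum-const (sum cs) _ ⟩
      + sum cs * columnProduct (c ∷ cs) x ∎
      where open ≡-Reasoning

  columnProduct-eigen : ∀ cs → IsPartition cs → (x : Vector ℤ (sum cs)) → Injective _≡_ _≡_ x →
                        pairSum (λ i j → columnProduct cs (x ∘ transpose i j)) ≡ content cs * columnProduct cs x
  columnProduct-eigen []           _                            x x-inj = refl
  columnProduct-eigen (suc d ∷ cs) (_ , cs≤c , cs-partition) x x-inj = begin
    pairSum swapped
      ≡⟨ pairSum-↑ c (sum cs) swapped ⟩
    pairSum (λ i j → swapped (i ↑ˡ sum cs) (j ↑ˡ sum cs))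
      + ∑[ i < c ] ∑[ j < sum cs ] swapped (i ↑ˡ sum cs) (c ↑ʳ j)
      + pairSum (λ i j → swapped (c ↑ʳ i) (c ↑ʳ j))
      ≡⟨ cong₂ _+_ (cong₂ _+_ (swaps-within-first-column c cs x) (swaps-across-first-column c cs x d refl cs≤c x-inj))
                   (trans (swaps-within-other-columns c cs x) (cong (vandermonde y *_) (columnProduct-eigen cs cs-partition ys (↑ʳ-inj c ∘ x-inj)))) ⟩
    + C₂ c * - (vandermonde y * F) + + sum cs * (vandermonde y * F) + vandermonde y * (content cs * F)
      ≡⟨ collect (+ C₂ c) (+ sum cs) (vandermonde y) F (content cs) ⟩
    content (c ∷ cs) * columnProduct (c ∷ cs) x ∎
    where
    open ≡-Reasoning
    c : ℕ
    c = suc d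
    y : Vector ℤ c
    y = x ∘ (_↑ˡ sum cs)
    ys : Vector ℤ (sum cs)
    ys = x ∘ (c ↑ʳ_)
    F : ℤ
    F = columnProduct cs ys
    swapped : Fin (c ℕ.+ sum cs) → Fin (c ℕ.+ sum cs) → ℤ
    swapped i j = columnProduct (c ∷ cs) (x ∘ transpose i j)
    collect : ∀ C N v f e → C * - (v * f) + N * (v * f) + v * (e * f) ≡ (e + N - C) * (v * f)
    collect = solve-∀

  private
    foldr-tabulate : ∀ n (f : Fin n → ℤ) → foldr _+_ 0ℤ (tabulate f) ≡ ∑[ i < n ] f i
    foldr-tabulate zero    f = refl
    foldr-tabulate (suc n) f = cong (λ t → f zero + t) (foldr-tabulate n (f ∘ suc))

  Σℤ≡∑ : ∀ n (f : Fin n → ℤ) → Σℤ n f ≡ ∑[ i < n ] f i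
  Σℤ≡∑ n f = trans (cong (foldr _+_ 0ℤ) (List.map-tabulate id f)) (foldr-tabulate n f)

  ordered-sum≡pairSum : ∀ n (h : Fin n → Fin n → ℤ) →
                        ∑[ i < n ] ∑[ j < n ] (if toℕ i <ᵇ toℕ j then h i j else 0ℤ) ≡ pairSum h
  ordered-sum≡pairSum zero    h = refl
  ordered-sum≡pairSum (suc n) h = cong₂ _+_ (ℤ.+-identityˡ (∑[ j < n ] h zero (suc j)))
    (trans (sum-cong-≗ λ i → ℤ.+-identityˡ (∑[ j < n ] ordered i j)) (ordered-sum≡pairSum n h′))
    where
    h′ : Fin n → Fin n → ℤ
    h′ i j = h (suc i) (suc j)
    ordered : Fin n → Fin n → ℤ
    ordered i j = if toℕ i <ᵇ toℕ j then h′ i j else 0ℤ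

  module _ (cs : List ℕ) (cs-partition : IsPartition cs) where

    spechtVector : Sym (sum cs) → ℤ
    spechtVector σ = columnProduct cs (λ k → + toℕ (σ ⟨$⟩ˡ k))

    private
      positions-inj : (σ : Sym (sum cs)) → Injective _≡_ _≡_ (λ k → + toℕ (σ ⟨$⟩ˡ k))
      positions-inj σ {k} {l} eq = begin
        k                       ≡⟨ Perm.inverseʳ σ ⟨
        σ ⟨$⟩ʳ (σ ⟨$⟩ˡ k)       ≡⟨ cong (σ ⟨$⟩ʳ_) (Fin.toℕ-injective (ℤ.+-injective eq)) ⟩
        σ ⟨$⟩ʳ (σ ⟨$⟩ˡ l)       ≡⟨ Perm.inverseʳ σ ⟩
        l                       ∎
        where open ≡-Reasoning

      inverse-cong : (σ τ : Sym (sum cs)) → σ Perm.≈ τ → ∀ k → σ ⟨$⟩ˡ k ≡ τ ⟨$⟩ˡ k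
      inverse-cong σ τ σ≈τ k = begin
        σ ⟨$⟩ˡ k                  ≡⟨ cong (σ ⟨$⟩ˡ_) (Perm.inverseʳ τ) ⟨
        σ ⟨$⟩ˡ (τ ⟨$⟩ʳ (τ ⟨$⟩ˡ k)) ≡⟨ cong (σ ⟨$⟩ˡ_) (σ≈τ (τ ⟨$⟩ˡ k)) ⟨
        σ ⟨$⟩ˡ (σ ⟨$⟩ʳ (τ ⟨$⟩ˡ k)) ≡⟨ Perm.inverseˡ σ ⟩
        τ ⟨$⟩ˡ k                  ∎
        where open ≡-Reasoning

    spechtVector-respects≈ : Respects≈ (sum cs) spechtVector
    spechtVector-respects≈ σ τ σ≈τ = columnProduct-cong cs (cong (+_ ∘ toℕ) ∘ inverse-cong σ τ σ≈τ)

    spechtVector-eigen : ∀ g → adjApply (sum cs) spechtVector g ≡ content cs * spechtVector g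
    spechtVector-eigen g = begin
      adjApply (sum cs) spechtVector g
        ≡⟨ trans (Σℤ≡∑ (sum cs) (λ i → Σℤ (sum cs) (ordered i))) (sum-cong-≗ λ i → Σℤ≡∑ (sum cs) (ordered i)) ⟩
      ∑[ i < sum cs ] ∑[ j < sum cs ] ordered i j
        ≡⟨ ordered-sum≡pairSum (sum cs) (λ i j → spechtVector (g ∘ₚ Perm.transpose i j)) ⟩
      pairSum (λ i j → spechtVector (g ∘ₚ Perm.transpose i j))
        ≡⟨ pairSum-cong (λ i j _ → columnProduct-cong cs λ k → cong (λ t → + toℕ (g ⟨$⟩ˡ t)) (transpose-comm j i k)) ⟩
      pairSum (λ i j → columnProduct cs ((λ k → + toℕ (g ⟨$⟩ˡ k)) ∘ transpose i j))
        ≡⟨ columnProduct-eigen cs cs-partition _ (positions-inj g) ⟩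
      content cs * spechtVector g ∎
      where
      open ≡-Reasoning
      ordered : Fin (sum cs) → Fin (sum cs) → ℤ
      ordered i j = if toℕ i <ᵇ toℕ j then spechtVector (g ∘ₚ Perm.transpose i j) else 0ℤ

    partition-content-eigenvalue : IsTranspositionGraphEigenvalue (sum cs) (content cs)
    partition-content-eigenvalue =
      spechtVector , spechtVector-respects≈ , (Perm.id , columnProduct≢0 cs _ (positions-inj Perm.id)) , spechtVector-eigen

module Frobenius where

  open import Data.Nat.Base as ℕ using (ℕ; zero; suc; _+_; _*_; _∸_; _≤_; _<_; z≤n; s≤s)
  import Data.Nat.Properties as ℕ
  open import Data.Nat.Tactic.RingSolver using () renaming (solve-∀ to ℕ-solve)
  open import Data.Integer.Base as ℤ using (ℤ; +_; -_) renaming (_+_ to _+ℤ_; _-_ to _-ℤ_)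
  import Data.Integer.Properties as ℤ
  open import Data.Integer.Tactic.RingSolver using (solve-∀)
  open import Data.List.Base using (List; []; _∷_; _++_; map; replicate; length)
  import Data.List.Properties as List
  open import Data.List.Relation.Unary.All as All using (All; []; _∷_)
  import Data.List.Relation.Unary.All.Properties as All
  open import Data.Nat.ListAction using (sum)
  open import Data.Nat.ListAction.Properties using (sum-++)
  open import Data.Product.Base using (Σ-syntax; _×_; _,_)
  open import Data.Unit.Base using (⊤; tt)
  open import Relation.Binary.PropositionalEquality
  open Choose2
  open YoungDiagram

  -- Frobenius coordinates: a diagram is a list of diagonal hooks (arm, leg),
  -- outermost first.
  Hook : Set
  Hook = ℕ × ℕ

  Nested : List Hook → Set
  Nested []                                 = ⊤
  Nested (_ ∷ [])                           = ⊤
  Nested ((a , b) ∷ (a′ , b′) ∷ H) = a′ < a × b′ < b × Nested ((a′ , b′) ∷ H)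

  size : List Hook → ℕ
  size []            = 0
  size ((a , b) ∷ H) = suc (a + b) + size H

  armContent legContent : List Hook → ℕ
  armContent []            = 0
  armContent ((a , b) ∷ H) = C₂ (suc a) + armContent H
  legContent []            = 0
  legContent ((a , b) ∷ H) = C₂ (suc b) + legContent H

  -- Wrapping a hook around a diagram adds a first column of length leg + 1,
  -- a cell on top of every old column, and new columns of length 1 up to the arm.
  columns : List Hook → List ℕ
  columns []            = []
  columns ((a , b) ∷ H) = suc b ∷ map suc (columns H) ++ replicate (a ∸ length (columns H)) 1

  width height : List Hook → ℕ
  width  []            = 0
  width  ((a , b) ∷ _) = suc a
  height []            = 0
  height ((a , b) ∷ _) = suc b

  private
    nested-tail : ∀ h H → Nested (h ∷ H) → Nested H
    nested-tail h []       _             = tt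
    nested-tail h (_ ∷ H) (_ , _ , nst) = nst

    width-tail : ∀ a b H → Nested ((a , b) ∷ H) → width H ≤ a
    width-tail a b []      _           = z≤n
    width-tail a b (_ ∷ H) (a′<a , _) = a′<a

    height-tail : ∀ a b H → Nested ((a , b) ∷ H) → height H ≤ b
    height-tail a b []      _               = z≤n
    height-tail a b (_ ∷ H) (_ , b′<b , _) = b′<b

  length-columns : ∀ H → Nested H → length (columns H) ≡ width H

  private
    length+fill : ∀ a b H → Nested ((a , b) ∷ H) → length (columns H) + (a ∸ length (columns H)) ≡ a
    length+fill a b H nst = ℕ.m+[n∸m]≡n (subst (_≤ a) (sym (length-columns H (nested-tail _ H nst))) (width-tail a b H nst))

  length-columns []            _   = refl
  length-columns ((a , b) ∷ H) nst = cong suc (begin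
    length (map suc (columns H) ++ replicate (a ∸ length (columns H)) 1)
      ≡⟨ List.length-++ (map suc (columns H)) ⟩
    length (map suc (columns H)) + length (replicate (a ∸ length (columns H)) 1)
      ≡⟨ cong₂ _+_ (List.length-map suc (columns H)) (List.length-replicate (a ∸ length (columns H))) ⟩
    length (columns H) + (a ∸ length (columns H))
      ≡⟨ length+fill a b H nst ⟩
    a ∎)
    where open ≡-Reasoning

  private
    wrapped-≤ : ∀ {m} cs r → All (_≤ m) cs → All (_≤ suc m) (map suc cs ++ replicate r 1)
    wrapped-≤ cs r cs≤m = All.++⁺ (All.map⁺ (All.map s≤s cs≤m)) (All.replicate⁺ r (s≤s z≤n))

    wrapped-partition : ∀ cs r → IsPartition cs → IsPartition (map suc cs ++ replicate r 1)
    wrapped-partition []       zero    _                         = tt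
    wrapped-partition []       (suc r) _                         = s≤s z≤n , All.replicate⁺ r (s≤s z≤n) , wrapped-partition [] r tt
    wrapped-partition (c ∷ cs) r       (_ , cs≤c , cs-partition) = s≤s z≤n , wrapped-≤ cs r cs≤c , wrapped-partition cs r cs-partition

  columns-≤-height : ∀ H → Nested H → All (_≤ height H) (columns H)
  columns-≤-height []            _   = []
  columns-≤-height ((a , b) ∷ H) nst = ℕ.≤-refl ∷ wrapped-≤ (columns H) _
    (All.map (λ c≤ → ℕ.≤-trans c≤ (height-tail a b H nst)) (columns-≤-height H (nested-tail _ H nst)))

  columns-partition : ∀ H → Nested H → IsPartition (columns H)
  columns-partition []            _   = tt
  columns-partition ((a , b) ∷ H) nst = s≤s z≤n , All.tail (columns-≤-height ((a , b) ∷ H) nst) ,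
    wrapped-partition (columns H) _ (columns-partition H (nested-tail _ H nst))

  private
    sum-wrapped : ∀ cs r → sum (map suc cs ++ replicate r 1) ≡ sum cs + (length cs + r)
    sum-wrapped cs r = begin
      sum (map suc cs ++ replicate r 1)       ≡⟨ sum-++ (map suc cs) (replicate r 1) ⟩
      sum (map suc cs) + sum (replicate r 1)  ≡⟨ cong₂ _+_ (sum-map-suc cs) (sum-replicate-1 r) ⟩
      sum cs + length cs + r                  ≡⟨ ℕ.+-assoc (sum cs) (length cs) r ⟩
      sum cs + (length cs + r)                ∎
      where open ≡-Reasoning

    content-wrapped : ∀ cs r → content (map suc cs ++ replicate r 1) ≡ content cs +ℤ + C₂ (length cs + r) -ℤ + sum cs
    content-wrapped cs r = begin
      content (map suc cs ++ replicate r 1)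
        ≡⟨ content-++ (map suc cs) (replicate r 1) ⟩
      content (map suc cs) +ℤ content (replicate r 1) +ℤ + (length (map suc cs) * sum (replicate r 1))
        ≡⟨ cong₂ _+ℤ_ (cong₂ _+ℤ_ (content-map-suc cs) (content-replicate-1 r))
                      (cong +_ (cong₂ _*_ (List.length-map suc cs) (sum-replicate-1 r))) ⟩
      content cs +ℤ + C₂ l -ℤ + sum cs +ℤ + C₂ r +ℤ + (l * r)
        ≡⟨ regroup (content cs) (+ C₂ l) (+ sum cs) (+ C₂ r) (+ (l * r)) ⟩
      content cs +ℤ (+ C₂ l +ℤ + C₂ r +ℤ + (l * r)) -ℤ + sum cs
        ≡⟨ cong (λ t → content cs +ℤ t -ℤ + sum cs) (trans (cong (_+ℤ + (l * r)) (ℤ.pos-+ (C₂ l) (C₂ r))) (ℤ.pos-+ (C₂ l + C₂ r) (l * r))) ⟨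
      content cs +ℤ + (C₂ l + C₂ r + l * r) -ℤ + sum cs
        ≡⟨ cong (λ t → content cs +ℤ + t -ℤ + sum cs) (C₂-+ l r) ⟨
      content cs +ℤ + C₂ (l + r) -ℤ + sum cs ∎
      where
      open ≡-Reasoning
      l : ℕ
      l = length cs
      regroup : ∀ e x s y z → e +ℤ x -ℤ s +ℤ y +ℤ z ≡ e +ℤ (x +ℤ y +ℤ z) -ℤ s
      regroup = solve-∀


  sum-columns : ∀ H → Nested H → sum (columns H) ≡ size H
  sum-columns []            _   = refl
  sum-columns ((a , b) ∷ H) nst = begin
    suc b + sum (map suc (columns H) ++ replicate (a ∸ length (columns H)) 1)
      ≡⟨ cong (λ t → suc b + t) (sum-wrapped (columns H) _) ⟩
    suc b + (sum (columns H) + (length (columns H) + (a ∸ length (columns H))))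
      ≡⟨ cong₂ (λ s w → suc b + (s + w)) (sum-columns H (nested-tail _ H nst)) (length+fill a b H nst) ⟩
    suc b + (size H + a)
      ≡⟨ cong suc (regroup a b (size H)) ⟩
    suc (a + b) + size H ∎
    where
    open ≡-Reasoning
    regroup : ∀ a b s → b + (s + a) ≡ a + b + s
    regroup = ℕ-solve

  content-columns : ∀ H → Nested H → content (columns H) ≡ + armContent H -ℤ + legContent H
  content-columns []            _   = refl
  content-columns ((a , b) ∷ H) nst = begin
    content rest +ℤ + sum rest -ℤ + C₂ (suc b)
      ≡⟨ cong₂ (λ e s → e +ℤ + s -ℤ + C₂ (suc b)) (content-wrapped (columns H) _) (sum-wrapped (columns H) _) ⟩
    content (columns H) +ℤ + C₂ (length (columns H) + r) -ℤ + sum (columns H) +ℤ + (sum (columns H) + (length (columns H) + r)) -ℤ + C₂ (suc b)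
      ≡⟨ cong₂ (λ e w → e +ℤ + C₂ w -ℤ + sum (columns H) +ℤ + (sum (columns H) + w) -ℤ + C₂ (suc b))
               (content-columns H (nested-tail _ H nst)) (length+fill a b H nst) ⟩
    + armContent H -ℤ + legContent H +ℤ + C₂ a -ℤ + sum (columns H) +ℤ + (sum (columns H) + a) -ℤ + C₂ (suc b)
      ≡⟨ cong (λ t → + armContent H -ℤ + legContent H +ℤ + C₂ a -ℤ + sum (columns H) +ℤ t -ℤ + C₂ (suc b)) (ℤ.pos-+ (sum (columns H)) a) ⟩
    + armContent H -ℤ + legContent H +ℤ + C₂ a -ℤ + sum (columns H) +ℤ (+ sum (columns H) +ℤ + a) -ℤ + C₂ (suc b)
      ≡⟨ regroup (+ armContent H) (+ legContent H) (+ C₂ a) (+ sum (columns H)) (+ a) (+ C₂ (suc b)) ⟩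
    (+ a +ℤ + C₂ a +ℤ + armContent H) -ℤ (+ C₂ (suc b) +ℤ + legContent H)
      ≡⟨ cong₂ _-ℤ_ (trans (cong (_+ℤ + armContent H) (ℤ.pos-+ a (C₂ a))) (ℤ.pos-+ (C₂ (suc a)) (armContent H)))
                    (ℤ.pos-+ (C₂ (suc b)) (legContent H)) ⟨
    + armContent ((a , b) ∷ H) -ℤ + legContent ((a , b) ∷ H) ∎
    where
    open ≡-Reasoning
    r : ℕ
    r = a ∸ length (columns H)
    rest : List ℕ
    rest = map suc (columns H) ++ replicate r 1
    regroup : ∀ p q c s a t → p -ℤ q +ℤ c -ℤ s +ℤ (s +ℤ a) -ℤ t ≡ (a +ℤ c +ℤ p) -ℤ (t +ℤ q)
    regroup = solve-∀

  FrobeniusWithContent : ℕ → ℕ → Set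
  FrobeniusWithContent n k = Σ[ H ∈ List Hook ] (Nested H × size H ≡ n × armContent H ≡ k + legContent H)

  PartitionWithContent : ℕ → ℤ → Set
  PartitionWithContent n k = Σ[ cs ∈ List ℕ ] (IsPartition cs × sum cs ≡ n × content cs ≡ k)

  frobenius⇒partition : ∀ {n k} → FrobeniusWithContent n k → PartitionWithContent n (+ k)
  frobenius⇒partition {n} {k} (H , nst , refl , arm≡k+leg) =
    columns H , columns-partition H nst , sum-columns H nst , (begin
      content (columns H)                 ≡⟨ content-columns H nst ⟩
      + armContent H -ℤ + legContent H    ≡⟨ cong (λ t → t -ℤ + legContent H) (trans (cong +_ arm≡k+leg) (ℤ.pos-+ k (legContent H))) ⟩
      + k +ℤ + legContent H -ℤ + legContent H ≡⟨ cancel (+ k) (+ legContent H) ⟩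
      + k                                 ∎)
    where
    open ≡-Reasoning
    cancel : ∀ a b → a +ℤ b -ℤ b ≡ a
    cancel = solve-∀

  conjugate : List Hook → List Hook
  conjugate = map λ (a , b) → (b , a)

  private
    conjugate-nested : ∀ H → Nested H → Nested (conjugate H)
    conjugate-nested []                    _                   = tt
    conjugate-nested (_ ∷ [])              _                   = tt
    conjugate-nested (_ ∷ h′ ∷ H) (a′<a , b′<b , nst) = b′<b , a′<a , conjugate-nested (h′ ∷ H) nst

    conjugate-size : ∀ H → size (conjugate H) ≡ size H
    conjugate-size []            = refl
    conjugate-size ((a , b) ∷ H) = cong₂ (λ s t → suc s + t) (ℕ.+-comm b a) (conjugate-size H)

    conjugate-arm : ∀ H → armContent (conjugate H) ≡ legContent H
    conjugate-arm []            = refl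
    conjugate-arm ((a , b) ∷ H) = cong (λ t → C₂ (suc b) + t) (conjugate-arm H)

    conjugate-leg : ∀ H → legContent (conjugate H) ≡ armContent H
    conjugate-leg []            = refl
    conjugate-leg ((a , b) ∷ H) = cong (λ t → C₂ (suc a) + t) (conjugate-leg H)

  frobenius⇒partition⁻ : ∀ {n k} → FrobeniusWithContent n k → PartitionWithContent n (- + k)
  frobenius⇒partition⁻ {n} {k} (H , nst , refl , arm≡k+leg) =
    columns (conjugate H) , columns-partition _ nst′ , trans (sum-columns _ nst′) (conjugate-size H) , (begin
      content (columns (conjugate H))
        ≡⟨ content-columns (conjugate H) nst′ ⟩
      + armContent (conjugate H) -ℤ + legContent (conjugate H)
        ≡⟨ cong₂ (λ a l → + a -ℤ + l) (conjugate-arm H) (trans (conjugate-leg H) arm≡k+leg) ⟩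
      + legContent H -ℤ + (k + legContent H)
        ≡⟨ cong (λ t → + legContent H -ℤ t) (ℤ.pos-+ k (legContent H)) ⟩
      + legContent H -ℤ (+ k +ℤ + legContent H)
        ≡⟨ cancel (+ k) (+ legContent H) ⟩
      - + k ∎)
    where
    open ≡-Reasoning
    nst′ : Nested (conjugate H)
    nst′ = conjugate-nested H nst
    cancel : ∀ a b → b -ℤ (a +ℤ b) ≡ - a
    cancel = solve-∀

module Construction where

  open import Data.Nat.Base using (ℕ; zero; suc; _+_; _*_; _≤_; _<_; z≤n; s≤s)
  import Data.Nat.Properties as ℕ
  open import Data.Nat.Tactic.RingSolver using (solve-∀)
  open import Data.List.Base using (List; []; _∷_)
  open import Data.Product.Base using (∃; _,_)
  open import Data.Unit.Base using (tt)
  open import Relation.Binary.PropositionalEquality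
  open Choose2
  open Frobenius

  singleColumn : ℕ → List Hook
  singleColumn zero    = []
  singleColumn (suc s) = (0 , s) ∷ []

  private
    singleColumn-size : ∀ s → size (singleColumn s) ≡ s
    singleColumn-size zero    = refl
    singleColumn-size (suc s) = cong suc (ℕ.+-identityʳ s)

    singleColumn-arm : ∀ s → armContent (singleColumn s) ≡ 0
    singleColumn-arm zero    = refl
    singleColumn-arm (suc s) = refl

    singleColumn-leg : ∀ s → legContent (singleColumn s) ≡ C₂ s
    singleColumn-leg zero    = refl
    singleColumn-leg (suc s) = ℕ.+-identityʳ (C₂ (suc s))

  twoHooks : ∀ {n k} s b₁ e₁ b₂ e₂ → b₂ < b₁ → b₂ + e₂ < b₁ + e₁ → Nested ((b₂ + e₂ , b₂) ∷ singleColumn s) →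
             n ≡ suc (b₁ + e₁ + b₁) + (suc (b₂ + e₂ + b₂) + s) →
             k + C₂ s ≡ b₁ * e₁ + C₂ (suc e₁) + (b₂ * e₂ + C₂ (suc e₂)) →
             FrobeniusWithContent n k
  twoHooks {n} {k} s b₁ e₁ b₂ e₂ b₂<b₁ a₂<a₁ inner n≡ k≡ = H , (a₂<a₁ , b₂<b₁ , inner) , size≡ , content≡
    where
    H : List Hook
    H = (b₁ + e₁ , b₁) ∷ (b₂ + e₂ , b₂) ∷ singleColumn s
    size≡ : size H ≡ n
    size≡ = trans (cong (λ t → suc (b₁ + e₁ + b₁) + (suc (b₂ + e₂ + b₂) + t)) (singleColumn-size s)) (sym n≡)
    content≡ : armContent H ≡ k + legContent H
    content≡ = begin
      C₂ (suc (b₁ + e₁)) + (C₂ (suc (b₂ + e₂)) + armContent (singleColumn s))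
        ≡⟨ cong₂ (λ x y → x + (y + armContent (singleColumn s))) (C₂-suc-+ b₁ e₁) (C₂-suc-+ b₂ e₂) ⟩
      C₂ (suc b₁) + b₁ * e₁ + C₂ (suc e₁) + (C₂ (suc b₂) + b₂ * e₂ + C₂ (suc e₂) + armContent (singleColumn s))
        ≡⟨ cong (λ t → C₂ (suc b₁) + b₁ * e₁ + C₂ (suc e₁) + (C₂ (suc b₂) + b₂ * e₂ + C₂ (suc e₂) + t)) (singleColumn-arm s) ⟩
      C₂ (suc b₁) + b₁ * e₁ + C₂ (suc e₁) + (C₂ (suc b₂) + b₂ * e₂ + C₂ (suc e₂) + 0)
        ≡⟨ regroup (C₂ (suc b₁)) (C₂ (suc b₂)) (b₁ * e₁) (C₂ (suc e₁)) (b₂ * e₂) (C₂ (suc e₂)) ⟩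
      b₁ * e₁ + C₂ (suc e₁) + (b₂ * e₂ + C₂ (suc e₂)) + (C₂ (suc b₁) + C₂ (suc b₂))
        ≡⟨ cong (_+ (C₂ (suc b₁) + C₂ (suc b₂))) (sym k≡) ⟩
      k + C₂ s + (C₂ (suc b₁) + C₂ (suc b₂))
        ≡⟨ regroup′ k (C₂ s) (C₂ (suc b₁)) (C₂ (suc b₂)) ⟩
      k + (C₂ (suc b₁) + (C₂ (suc b₂) + C₂ s))
        ≡⟨ cong (λ t → k + (C₂ (suc b₁) + (C₂ (suc b₂) + t))) (singleColumn-leg s) ⟨
      k + legContent H ∎
      where
      open ≡-Reasoning
      regroup : ∀ x y p₁ t₁ p₂ t₂ → x + p₁ + t₁ + (y + p₂ + t₂ + 0) ≡ p₁ + t₁ + (p₂ + t₂) + (x + y)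
      regroup = solve-∀
      regroup′ : ∀ k c x y → k + c + (x + y) ≡ k + (x + (y + c))
      regroup′ = solve-∀

  ≤⇒gap : ∀ {a b} → a ≤ b → ∃ λ e → b ≡ a + e
  ≤⇒gap a≤b with ℕ.m≤n⇒∃[o]m+o≡n a≤b
  ... | e , a+e≡b = e , sym a+e≡b

  gap⇒≤ : ∀ {a b} e → a + e ≡ b → a ≤ b
  gap⇒≤ {a} e a+e≡b = subst (a ≤_) a+e≡b (ℕ.m≤m+n a e)

  inside-column : ∀ {a b} s → s ≤ a → s ≤ b → Nested ((a , b) ∷ singleColumn s)
  inside-column zero    _   _   = tt
  inside-column (suc s) s<a s<b = ℕ.<-≤-trans (s≤s z≤n) s<a , s<b , tt

  consecutive-excesses : ∀ b₁ b₂ δ → b₁ * δ + b₂ * suc δ + suc δ * suc δ ≡ b₁ * δ + C₂ (suc δ) + (b₂ * suc δ + C₂ (suc (suc δ)))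
  consecutive-excesses b₁ b₂ δ = trans (cong (λ t → b₁ * δ + b₂ * suc δ + t) (sym (C₂-consecutive δ)))
                                       (regroup (b₁ * δ) (b₂ * suc δ) (C₂ (suc δ)) (C₂ (suc (suc δ))))
    where regroup : ∀ p q x y → p + q + (x + y) ≡ p + x + (q + y)
          regroup = solve-∀

  -- In both templates n = 2h + 1 + s and k + C₂ s = δ (h + 1) + u; the hooks
  -- have legs u - 1 and h - δ - u, with arm excesses δ and δ + 1 in either order.
  templatePlus : ∀ {n k} s h δ u → n ≡ h + h + suc s → k + C₂ s ≡ δ * suc h + u →
                 suc s ≤ u → 2 * u + δ + 1 ≤ h → FrobeniusWithContent n k
  templatePlus s h δ u n≡ k≡ s<u room with ≤⇒gap s<u | ≤⇒gap room
  ... | x , refl | e , refl =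
    twoHooks s (s + x + 2 + e) δ (s + x) (suc δ) (gap⇒≤ (suc e) (legs s x e)) (gap⇒≤ e (arms s x e δ))
      (inside-column s (gap⇒≤ (x + suc δ) (sym (ℕ.+-assoc s x (suc δ)))) (ℕ.m≤m+n s x))
      (trans n≡ (sizes s x e δ))
      (trans k≡ (trans (contents s x e δ) (consecutive-excesses (s + x + 2 + e) (s + x) δ)))
    where
    legs : ∀ s x e → suc (s + x) + suc e ≡ s + x + 2 + e
    legs = solve-∀
    arms : ∀ s x e δ → suc (s + x + suc δ) + e ≡ s + x + 2 + e + δ
    arms = solve-∀
    sizes : ∀ s x e δ → 2 * suc (s + x) + δ + 1 + e + (2 * suc (s + x) + δ + 1 + e) + suc s
                      ≡ suc (s + x + 2 + e + δ + (s + x + 2 + e)) + (suc (s + x + suc δ + (s + x)) + s)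
    sizes = solve-∀
    contents : ∀ s x e δ → δ * suc (2 * suc (s + x) + δ + 1 + e) + suc (s + x)
                         ≡ (s + x + 2 + e) * δ + (s + x) * suc δ + suc δ * suc δ
    contents = solve-∀

  private
    leg-gap : ∀ u δ s f → u + δ + s + f + 2 ≤ 2 * u + δ → s + f + 2 ≤ u
    leg-gap u δ s f crowded = ℕ.+-cancelˡ-≤ (u + δ) (s + f + 2) u (subst₂ _≤_ (lower u δ s f) (upper u δ) crowded)
      where
      lower : ∀ u δ s f → u + δ + s + f + 2 ≡ u + δ + (s + f + 2)
      lower = solve-∀
      upper : ∀ u δ → 2 * u + δ ≡ u + δ + u
      upper = solve-∀

  templateMinus : ∀ {n k} s h δ u → n ≡ h + h + suc s → k + C₂ s ≡ δ * suc h + u →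
                  h + 2 ≤ 2 * u + δ → u + δ + s ≤ h → FrobeniusWithContent n k
  templateMinus s h δ u n≡ k≡ crowded room with ≤⇒gap room
  ... | f , refl with ≤⇒gap (leg-gap u δ s f crowded)
  ...   | g , refl =
    twoHooks s (s + f + 1 + g) (suc δ) (s + f) δ (gap⇒≤ g (legs s f g)) (gap⇒≤ (1 + g) (arms s f g δ))
      (inside-column s (gap⇒≤ (f + δ) (sym (ℕ.+-assoc s f δ))) (ℕ.m≤m+n s f))
      (trans n≡ (sizes s f g δ))
      (trans k≡ (trans (contents s f g δ) (trans (consecutive-excesses (s + f) (s + f + 1 + g) δ)
        (ℕ.+-comm ((s + f) * δ + C₂ (suc δ)) _))))
    where
    legs : ∀ s f g → suc (s + f) + g ≡ s + f + 1 + g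
    legs = solve-∀
    arms : ∀ s f g δ → suc (s + f + δ) + (1 + g) ≡ s + f + 1 + g + suc δ
    arms = solve-∀
    sizes : ∀ s f g δ → s + f + 2 + g + δ + s + f + (s + f + 2 + g + δ + s + f) + suc s
                      ≡ suc (s + f + 1 + g + suc δ + (s + f + 1 + g)) + (suc (s + f + δ + (s + f)) + s)
    sizes = solve-∀
    contents : ∀ s f g δ → δ * suc (s + f + 2 + g + δ + s + f) + (s + f + 2 + g)
                         ≡ (s + f) * δ + (s + f + 1 + g) * suc δ + suc δ * suc δ
    contents = solve-∀

module Generic where

  open import Data.Nat.Base using (ℕ; zero; suc; _+_; _*_; _/_; _%_; _≤_; z≤n; s≤s)
  open import Data.Nat.DivMod using (m≡m%n+[m/n]*n; m%n<n)
  import Data.Nat.Properties as ℕ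
  open import Data.Nat.Tactic.RingSolver using (solve-∀)
  open import Data.Product.Base using (_×_; _,_)
  open import Relation.Binary.PropositionalEquality
  open import Relation.Nullary using (yes; no)
  open Choose2
  open Frobenius
  open Construction

  private
    quotient-one : ∀ δ p u q → δ + p + u ≤ 1 → u ≤ p → 1 ≤ δ * q + u → δ ≡ 1 × p ≡ 0 × u ≡ 0
    quotient-one zero       zero    zero    q _         _  ()
    quotient-one zero       zero    (suc u) q _         () _
    quotient-one zero       (suc p) zero    q _         _  ()
    quotient-one zero       (suc p) (suc u) q (s≤s ≤0) _  _ with () ← ℕ.m+n≤o⇒n≤o p ≤0
    quotient-one (suc zero) zero    zero    q _         _  _ = refl , refl , refl
    quotient-one (suc zero) (suc p) u       q (s≤s ()) _  _
    quotient-one (suc zero) zero    (suc u) q (s≤s ()) _  _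
    quotient-one (suc (suc δ)) p    u       q (s≤s ()) _  _

  -- n = 2h + 1 + p and k = δ (h + 1) + u with u ≤ h = 3δ + 6p + 20 + w. Depending
  -- on where u lies, one of the templates applies with a column of p, p + 2 or
  -- p + 4 cells; the longer columns lower h by 1 or 2 and shift the remainder.
  module _ (p δ u w : ℕ) (C₂p≡0 : C₂ p ≡ 0) where

    private
      h₂ h₁ h : ℕ
      h₂ = 3 * δ + 6 * p + 18 + w
      h₁ = suc h₂
      h  = suc h₁

      Goal : Set
      Goal = FrobeniusWithContent (h + h + suc p) (δ * suc h + u)

      k+C₂p : δ * suc h + u + C₂ p ≡ δ * suc h + u
      k+C₂p = trans (cong (δ * suc h + u +_) C₂p≡0) (ℕ.+-identityʳ _)

      n≡₂ : h + h + suc p ≡ h₁ + h₁ + suc (2 + p)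
      n≡₂ = shift h₁ p
        where shift : ∀ h p → suc h + suc h + suc p ≡ h + h + suc (2 + p)
              shift = solve-∀

      u₁ : ℕ
      u₁ = u + δ + 2 * p + 1

      k≡₂ : δ * suc h + u + C₂ (2 + p) ≡ δ * suc h₁ + u₁
      k≡₂ = trans (cong (λ t → δ * suc h + u + (suc p + (p + t))) C₂p≡0) (shift δ h₁ u p)
        where shift : ∀ δ h u p → δ * suc (suc h) + u + (suc p + (p + 0)) ≡ δ * suc h + (u + δ + 2 * p + 1)
              shift = solve-∀

      plus₀ : suc p ≤ u → 2 * u + δ + 1 ≤ h → Goal
      plus₀ = templatePlus p h δ u refl k+C₂p

      minus₀ : h + 2 ≤ 2 * u + δ → u + δ + p ≤ h → Goal
      minus₀ = templateMinus p h δ u refl k+C₂p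

      plus₂ : u ≤ p → 2 ≤ δ + p + u → Goal
      plus₂ u≤p 2≤ with ≤⇒gap u≤p | ≤⇒gap 2≤
      ... | x , refl | y , δ+p+u≡2+y = templatePlus (2 + p) h₁ δ u₁ n≡₂ k≡₂
        (gap⇒≤ y (trans (lift u x y) (trans (cong (λ t → u + x + 1 + t) (sym δ+p+u≡2+y)) (unlift u x δ))))
        (gap⇒≤ (16 + w + 2 * x) (room u x δ w))
        where
        lift : ∀ u x y → suc (2 + (u + x)) + y ≡ u + x + 1 + (2 + y)
        lift = solve-∀
        unlift : ∀ u x δ → u + x + 1 + (δ + (u + x) + u) ≡ u + δ + 2 * (u + x) + 1
        unlift = solve-∀
        room : ∀ u x δ w → 2 * (u + δ + 2 * (u + x) + 1) + δ + 1 + (16 + w + 2 * x) ≡ suc (3 * δ + 6 * (u + x) + 18 + w)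
        room = solve-∀

      minus₂ : h ≤ 2 * u + δ → 2 * u + δ ≤ suc h → Goal
      minus₂ h≤ ≤1+h with ≤⇒gap ≤1+h
      ... | x , 1+h≡ = templateMinus (2 + p) h₁ δ u₁ n≡₂ k≡₂
        (subst (_≤ 2 * u₁ + δ) (sym (ℕ.+-comm h₁ 2)) (ℕ.≤-trans (s≤s h≤) (gap⇒≤ (2 * δ + 4 * p + 1) (widen u δ p))))
        (ℕ.*-cancelˡ-≤ 2 (gap⇒≤ (11 + w + x) (begin
          2 * (u₁ + δ + (2 + p)) + (11 + w + x)     ≡⟨ regroup u δ p w x ⟩
          2 * u + δ + x + (3 * δ + 6 * p + 17 + w) ≡⟨ cong (_+ (3 * δ + 6 * p + 17 + w)) (sym 1+h≡) ⟩
          suc h + (3 * δ + 6 * p + 17 + w)          ≡⟨ double δ p w ⟩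
          2 * h₁                                    ∎)))
        where
        open ≡-Reasoning
        widen : ∀ u δ p → suc (2 * u + δ) + (2 * δ + 4 * p + 1) ≡ 2 * (u + δ + 2 * p + 1) + δ
        widen = solve-∀
        regroup : ∀ u δ p w x → 2 * (u + δ + 2 * p + 1 + δ + (2 + p)) + (11 + w + x) ≡ 2 * u + δ + x + (3 * δ + 6 * p + 17 + w)
        regroup = solve-∀
        double : ∀ δ p w → suc (suc (suc (3 * δ + 6 * p + 18 + w))) + (3 * δ + 6 * p + 17 + w) ≡ 2 * suc (3 * δ + 6 * p + 18 + w)
        double = solve-∀

      plus₂′ : u ≤ h → h + 2 ≤ u + δ + p → Goal
      plus₂′ u≤h h+2≤ with ≤⇒gap u≤h | ≤⇒gap h+2≤
      ... | v , h≡u+v | z , u+δ+p≡ = templatePlus (2 + p) h₁ (suc δ) (z + p + 3) n≡₂ k≡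
        (gap⇒≤ z (shift p z))
        (gap⇒≤ (2 * v + 2 * p + 15 + w) room)
        where
        shift : ∀ p z → suc (2 + p) + z ≡ z + p + 3
        shift = solve-∀
        k≡ : δ * suc h + u + C₂ (2 + p) ≡ suc δ * suc h₁ + (z + p + 3)
        k≡ = trans k≡₂ (trans (expose δ h₁ u p) (trans (cong (λ t → δ * suc h₁ + t + p + 1) u+δ+p≡) (absorb δ h₁ z p)))
          where expose : ∀ δ h u p → δ * suc h + (u + δ + 2 * p + 1) ≡ δ * suc h + (u + δ + p) + p + 1
                expose = solve-∀
                absorb : ∀ δ h z p → δ * suc h + (suc h + 2 + z) + p + 1 ≡ suc δ * suc h + (z + p + 3)
                absorb = solve-∀
        δ+p≡ : δ + p ≡ z + 2 + v
        δ+p≡ = ℕ.+-cancelˡ-≡ h _ _ (begin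
          h + (δ + p)     ≡⟨ cong (_+ (δ + p)) h≡u+v ⟩
          u + v + (δ + p) ≡⟨ swap u v δ p ⟩
          u + δ + p + v   ≡⟨ cong (_+ v) u+δ+p≡ ⟩
          h + 2 + z + v   ≡⟨ regroup h z v ⟩
          h + (z + 2 + v) ∎)
          where
          open ≡-Reasoning
          swap : ∀ u v δ p → u + v + (δ + p) ≡ u + δ + p + v
          swap = solve-∀
          regroup : ∀ h z v → h + 2 + z + v ≡ h + (z + 2 + v)
          regroup = solve-∀
        room : 2 * (z + p + 3) + suc δ + 1 + (2 * v + 2 * p + 15 + w) ≡ h₁
        room = trans (regroup z p δ v w) (trans (cong (λ t → 2 * t + 4 * p + δ + 19 + w) (sym δ+p≡)) (collect δ p w))
          where regroup : ∀ z p δ v w → 2 * (z + p + 3) + suc δ + 1 + (2 * v + 2 * p + 15 + w) ≡ 2 * (z + 2 + v) + 4 * p + δ + 19 + w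
                regroup = solve-∀
                collect : ∀ δ p w → 2 * (δ + p) + 4 * p + δ + 19 + w ≡ suc (3 * δ + 6 * p + 18 + w)
                collect = solve-∀

      plus₄ : u + δ + p ≡ suc h → Goal
      plus₄ u+δ+p≡ = templatePlus (4 + p) h₂ (suc δ) (δ + 3 * p + 8) (shift h₂ p) k≡
        (gap⇒≤ (δ + 2 * p + 3) (margin δ p)) (gap⇒≤ w (room δ p w))
        where
        shift : ∀ h p → suc (suc h) + suc (suc h) + suc p ≡ h + h + suc (4 + p)
        shift = solve-∀
        margin : ∀ δ p → suc (4 + p) + (δ + 2 * p + 3) ≡ δ + 3 * p + 8
        margin = solve-∀
        room : ∀ δ p w → 2 * (δ + 3 * p + 8) + suc δ + 1 + w ≡ 3 * δ + 6 * p + 18 + w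
        room = solve-∀
        k≡ : δ * suc h + u + C₂ (4 + p) ≡ suc δ * suc h₂ + (δ + 3 * p + 8)
        k≡ = begin
          δ * suc h + u + C₂ (4 + p)
            ≡⟨ cong (λ t → δ * suc h + u + (3 + p + (2 + p + (suc p + (p + t))))) C₂p≡0 ⟩
          δ * suc h + u + (3 + p + (2 + p + (suc p + (p + 0))))
            ≡⟨ expose δ h₂ u p ⟩
          δ * suc h₂ + δ + (u + δ + p) + 3 * p + 6
            ≡⟨ cong (λ t → δ * suc h₂ + δ + t + 3 * p + 6) u+δ+p≡ ⟩
          δ * suc h₂ + δ + suc h + 3 * p + 6
            ≡⟨ absorb δ h₂ p ⟩
          suc δ * suc h₂ + (δ + 3 * p + 8) ∎
          where
          open ≡-Reasoning
          expose : ∀ δ h u p → δ * suc (suc (suc h)) + u + (3 + p + (2 + p + (suc p + (p + 0))))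
                             ≡ δ * suc h + δ + (u + δ + p) + 3 * p + 6
          expose = solve-∀
          absorb : ∀ δ h p → δ * suc h + δ + suc (suc (suc h)) + 3 * p + 6 ≡ suc δ * suc h + (δ + 3 * p + 8)
          absorb = solve-∀

      plus₄-unit : δ ≡ 1 → p ≡ 0 → u ≡ 0 → Goal
      plus₄-unit refl refl refl = templatePlus 4 h₂ 1 8 (shift h₂) (absorb h₂) (gap⇒≤ 3 refl) (gap⇒≤ (3 + w) (room w))
        where
        shift : ∀ h → suc (suc h) + suc (suc h) + 1 ≡ h + h + 5
        shift = solve-∀
        absorb : ∀ h → 1 * suc (suc (suc h)) + 0 + 6 ≡ 1 * suc h + 8
        absorb = solve-∀
        room : ∀ w → 2 * 8 + 1 + 1 + (3 + w) ≡ 3 * 1 + 6 * 0 + 18 + w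
        room = solve-∀

    generic : u ≤ h → 1 ≤ δ * suc h + u → Goal
    generic u≤h 1≤k with u ℕ.≤? p
    ... | yes u≤p with 2 ℕ.≤? δ + p + u
    ...   | yes 2≤ = plus₂ u≤p 2≤
    ...   | no  2≰ with quotient-one δ p u (suc h) (ℕ.≤-pred (ℕ.≰⇒> 2≰)) u≤p 1≤k
    ...     | δ≡1 , p≡0 , u≡0 = plus₄-unit δ≡1 p≡0 u≡0
    generic u≤h 1≤k | no u≰p with 2 * u + δ + 1 ℕ.≤? h
    ... | yes room = plus₀ (ℕ.≰⇒> u≰p) room
    ... | no  h<   with 2 * u + δ ℕ.≤? suc h
    ...   | yes tight = minus₂ (ℕ.≤-pred (subst (suc h ≤_) (ℕ.+-comm (2 * u + δ) 1) (ℕ.≰⇒> h<))) tight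
    ...   | no  h+1< with u + δ + p ℕ.≤? h
    ...     | yes room′ = minus₀ (subst (_≤ 2 * u + δ) (ℕ.+-comm 2 h) (ℕ.≰⇒> h+1<)) room′
    ...     | no  h<′ with u + δ + p ℕ.≤? suc h
    ...       | yes ≤h+1 = plus₄ (ℕ.≤-antisym ≤h+1 (ℕ.≰⇒> h<′))
    ...       | no  h+1<′ = plus₂′ u≤h (subst (_≤ u + δ + p) (ℕ.+-comm 2 h) (ℕ.≰⇒> h+1<′))

  private
    C₂-≤1 : ∀ {p} → p ≤ 1 → C₂ p ≡ 0
    C₂-≤1 z≤n       = refl
    C₂-≤1 (s≤s z≤n) = refl

  frobenius-generic : ∀ {n k} h p → p ≤ 1 → n ≡ h + h + suc p → 3 * (k / suc h) + 6 * p + 20 ≤ h → 1 ≤ k →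
                    FrobeniusWithContent n k
  frobenius-generic {k = k} h p p≤1 refl roomy 1≤k with ≤⇒gap roomy
  ... | w , h≡ = subst (λ h → FrobeniusWithContent (h + h + suc p) k) (sym h≡H)
    (subst (FrobeniusWithContent _) (sym k≡) (generic p δ u w (C₂-≤1 p≤1) u≤H (subst (1 ≤_) k≡ 1≤k)))
    where
    δ u : ℕ
    δ = k / suc h
    u = k % suc h
    h≡H : h ≡ suc (suc (3 * δ + 6 * p + 18 + w))
    h≡H = trans h≡ (unfold δ p w)
      where unfold : ∀ δ p w → 3 * δ + 6 * p + 20 + w ≡ suc (suc (3 * δ + 6 * p + 18 + w))
            unfold = solve-∀
    k≡ : k ≡ δ * suc (suc (suc (3 * δ + 6 * p + 18 + w))) + u
    k≡ = trans (m≡m%n+[m/n]*n k (suc h)) (trans (ℕ.+-comm u (δ * suc h)) (cong (λ t → δ * suc t + u) h≡H))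
    u≤H : u ≤ suc (suc (3 * δ + 6 * p + 18 + w))
    u≤H = subst (u ≤_) h≡H (ℕ.≤-pred (m%n<n k (suc h)))

module Bound where

  open import Data.Nat.Base using (ℕ; suc; _+_; _*_; _∸_; _/_; _%_; _≤_; _<_; z≤n; s≤s; NonZero)
  import Data.Nat.Properties as ℕ
  open import Data.Nat.DivMod using (m≡m%n+[m/n]*n; m%n<n; m/n*n≤m)
  open import Data.Nat.Tactic.RingSolver using (solve-∀)
  open import Relation.Binary.PropositionalEquality
  open import Relation.Nullary using (yes; no)
  open import Relation.Nullary.Negation using (contradiction)
  open Choose2

  half parity : ℕ → ℕ
  half   n = (n ∸ 1) / 2
  parity n = (n ∸ 1) % 2

  parity≤1 : ∀ n → parity n ≤ 1
  parity≤1 n = ℕ.≤-pred (m%n<n (n ∸ 1) 2)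

  half-parity : ∀ n → 1 ≤ n → n ≡ half n + half n + suc (parity n)
  half-parity (suc n) _ = trans (cong suc (m≡m%n+[m/n]*n n 2)) (regroup (parity (suc n)) (half (suc n)))
    where regroup : ∀ p h → suc (p + h * 2) ≡ h + h + suc p
          regroup = solve-∀

  -- Otherwise m (3 m + 15) ≤ 6 (k / q) q ≤ 6 C₂ m = 3 m (m - 1).
  quotient-small : ∀ m q k .{{_ : NonZero q}} → 1 ≤ m → 3 * m + 15 ≤ 2 * q → k ≤ C₂ m → 3 * (k / q) < m
  quotient-small m q k 1≤m 3m+15≤2q k≤ with 3 * (k / q) ℕ.<? m
  ... | yes lt = lt
  ... | no  ≮  = contradiction 18m≤0 (ℕ.<⇒≱ (ℕ.≤-trans (s≤s z≤n) (ℕ.*-monoʳ-≤ 18 1≤m)))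
    where
    δ : ℕ
    δ = k / q
    chain : m * (3 * m + 15) ≤ 6 * C₂ m
    chain = begin
      m * (3 * m + 15) ≤⟨ ℕ.*-monoʳ-≤ m 3m+15≤2q ⟩
      m * (2 * q)      ≤⟨ ℕ.*-monoˡ-≤ (2 * q) (ℕ.≮⇒≥ ≮) ⟩
      3 * δ * (2 * q)  ≡⟨ regroup δ q ⟩
      6 * (δ * q)      ≤⟨ ℕ.*-monoʳ-≤ 6 (ℕ.≤-trans (m/n*n≤m k q) k≤) ⟩
      6 * C₂ m         ∎
      where open ℕ.≤-Reasoning
            regroup : ∀ d q → 3 * d * (2 * q) ≡ 6 * (d * q)
            regroup = solve-∀
    18m≤0 : 18 * m ≤ 0
    18m≤0 = ℕ.+-cancelˡ-≤ (3 * (m * m)) (18 * m) 0 (subst₂ _≤_ (expand m)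
      (trans (regroup (C₂ m) m) (trans (cong (3 *_) (C₂-double m)) (sym (ℕ.+-identityʳ _))))
      (ℕ.+-monoˡ-≤ (3 * m) chain))
      where expand : ∀ m → m * (3 * m + 15) + 3 * m ≡ 3 * (m * m) + 18 * m
            expand = solve-∀
            regroup : ∀ c m → 6 * c + 3 * m ≡ 3 * (c + c + m)
            regroup = solve-∀

  private
    module FloorThird (n : ℕ) (15≤n : 15 ≤ n) where
      m r : ℕ
      m = (n ∸ 15) / 3
      r = (n ∸ 15) % 3

      n≡ : n ≡ 3 * m + 15 + r
      n≡ = trans (sym (ℕ.m+[n∸m]≡n 15≤n)) (trans (cong (15 +_) (m≡m%n+[m/n]*n (n ∸ 15) 3)) (regroup m r))
        where regroup : ∀ m r → 15 + (r + m * 3) ≡ 3 * m + 15 + r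
              regroup = solve-∀

      3m+15≤n : 3 * m + 15 ≤ n
      3m+15≤n = subst (3 * m + 15 ≤_) (sym n≡) (ℕ.m≤m+n (3 * m + 15) r)

      n≤3m+17 : n ≤ 3 * m + 17
      n≤3m+17 = subst₂ _≤_ (sym n≡) (ℕ.+-assoc (3 * m) 15 2) (ℕ.+-monoʳ-≤ (3 * m + 15) (ℕ.≤-pred (m%n<n (n ∸ 15) 3)))

  GenericApplies : ℕ → ℕ → Set
  GenericApplies n k = 3 * (k / suc (half n)) + 6 * parity n + 20 ≤ half n

  generic-applies-for-large : ∀ n k → 126 ≤ n → k ≤ C₂ ((n ∸ 15) / 3) → GenericApplies n k
  generic-applies-for-large n k 126≤n k≤ = ℕ.*-cancelˡ-≤ 2 (ℕ.+-cancelʳ-≤ 2 _ _ (begin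
    2 * (3 * δ + 6 * p + 20) + 2         ≡⟨ regroup δ p ⟩
    2 * (3 * δ + 1) + 12 * p + 40        ≤⟨ ℕ.+-monoˡ-≤ 40 (ℕ.+-mono-≤ (ℕ.*-monoʳ-≤ 2 3δ<m) (ℕ.*-monoʳ-≤ 12 (parity≤1 n))) ⟩
    2 * m + 12 * 1 + 40                  ≡⟨ ℕ.+-assoc (2 * m) 12 40 ⟩
    2 * m + (37 + 15)                    ≤⟨ ℕ.+-monoʳ-≤ (2 * m) (ℕ.+-monoˡ-≤ 15 37≤m) ⟩
    2 * m + (m + 15)                     ≡⟨ collect m ⟩
    3 * m + 15                           ≤⟨ 3m+15≤2+2h ⟩
    2 * suc h                            ≡⟨ suc-double h ⟩
    2 * h + 2                            ∎))
    where
    open FloorThird n (ℕ.≤-trans (ℕ.m≤m+n 15 111) 126≤n)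
    open ℕ.≤-Reasoning
    h p δ : ℕ
    h = half n
    p = parity n
    δ = k / suc h
    37≤m : 37 ≤ m
    37≤m with 37 ℕ.≤? m
    ... | yes 37≤ = 37≤
    ... | no  37≰ = contradiction (ℕ.≤-trans n≤3m+17 (ℕ.+-monoˡ-≤ 17 (ℕ.*-monoʳ-≤ 3 (ℕ.≤-pred (ℕ.≰⇒> 37≰))))) (ℕ.<⇒≱ 126≤n)
    h+h+2≡ : ∀ h → h + h + 2 ≡ 2 * suc h
    h+h+2≡ = solve-∀
    3m+15≤2+2h : 3 * m + 15 ≤ 2 * suc h
    3m+15≤2+2h = ℕ.≤-trans 3m+15≤n (subst (_≤ 2 * suc h) (sym (half-parity n (ℕ.≤-trans (s≤s z≤n) 126≤n)))
      (subst (h + h + suc p ≤_) (h+h+2≡ h) (ℕ.+-monoʳ-≤ (h + h) (s≤s (parity≤1 n)))))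
    3δ<m : 3 * δ + 1 ≤ m
    3δ<m = subst (_≤ m) (ℕ.+-comm 1 (3 * δ)) (quotient-small m (suc h) k (ℕ.≤-trans (s≤s z≤n) 37≤m) 3m+15≤2+2h k≤)
    regroup : ∀ δ p → 2 * (3 * δ + 6 * p + 20) + 2 ≡ 2 * (3 * δ + 1) + 12 * p + 40
    regroup = solve-∀
    collect : ∀ m → 2 * m + (m + 15) ≡ 3 * m + 15
    collect = solve-∀
    suc-double : ∀ h → 2 * suc h ≡ 2 * h + 2
    suc-double = solve-∀

module SmallCases where

  open import Data.Nat.Base using (ℕ; suc; _+_; _∸_; _/_; _%_; _≤_; _<_)
  open import Data.Nat.Properties as ℕ using (_≟_; _≤?_; _<?_)
  open import Data.List.Base using (List; []; _∷_; concatMap; applyUpTo)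
  open import Data.List.Relation.Unary.All as All using (All)
  open import Data.List.Relation.Unary.All.Properties using (applyUpTo⁻)
  open import Data.List.Relation.Unary.Any as Any using (Any)
  open import Data.Product.Base using (_×_; _,_)
  open import Data.Sum.Base using (_⊎_)
  open import Data.Unit.Base using (tt)
  open import Relation.Binary.PropositionalEquality using (_≡_; subst; sym)
  open import Relation.Nullary.Decidable using (Dec; yes; _×-dec_; _⊎-dec_; toWitness)
  open Choose2
  open Frobenius
  open Bound using (GenericApplies)

  nested? : ∀ H → Dec (Nested H)
  nested? []                        = yes tt
  nested? (_ ∷ [])                  = yes tt
  nested? ((a , b) ∷ (a′ , b′) ∷ H) = a′ <? a ×-dec b′ <? b ×-dec nested? ((a′ , b′) ∷ H)

  Witnesses : ℕ → ℕ → List Hook → Set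
  Witnesses n k H = Nested H × size H ≡ n × armContent H ≡ k + legContent H

  witnesses? : ∀ n k H → Dec (Witnesses n k H)
  witnesses? n k H = nested? H ×-dec size H ≟ n ×-dec armContent H ≟ k + legContent H

  -- The two templates wrapped around a few small diagrams G (with truncated
  -- subtraction, so candidates may be invalid: each one is checked).
  candidates : ℕ → ℕ → List (List Hook)
  candidates n k = concatMap around
    ([] ∷ ((0 , 0) ∷ []) ∷ ((0 , 1) ∷ []) ∷ ((1 , 0) ∷ []) ∷ ((1 , 1) ∷ []) ∷ ((0 , 2) ∷ []) ∷ ((2 , 0) ∷ []) ∷
     ((0 , 3) ∷ []) ∷ ((3 , 0) ∷ []) ∷ ((1 , 1) ∷ (0 , 0) ∷ []) ∷ ((1 , 2) ∷ []) ∷ ((2 , 1) ∷ []) ∷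
     ((0 , 4) ∷ []) ∷ ((4 , 0) ∷ []) ∷ ((2 , 2) ∷ []) ∷ ((1 , 3) ∷ []) ∷ ((3 , 1) ∷ []) ∷ [])
    where
    around : List Hook → List (List Hook)
    around G = ((short + δ , short) ∷ (long + δ + 1 , long) ∷ G)
             ∷ ((long + δ + 1 , long) ∷ (short + δ , short) ∷ G) ∷ []
      where
      h K δ u long short : ℕ
      h = (n ∸ size G ∸ 1) / 2
      K = k + legContent G ∸ armContent G
      δ = K / suc h
      u = K % suc h
      long  = u ∸ 1
      short = h ∸ δ ∸ u

  SmallCase : ℕ → ℕ → Set
  SmallCase n k = GenericApplies n k ⊎ Any (Witnesses n k) (candidates n k)

  Row : ℕ → Set
  Row n = All (SmallCase n) (applyUpTo suc (C₂ ((n ∸ 15) / 3)))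

  small-cases : All Row (applyUpTo (27 +_) 99)
  small-cases = toWitness {a? = All.all? (λ n → All.all? (λ k → _ ≤? _ ⊎-dec Any.any? (witnesses? n k) (candidates n k)) _) _} tt

  small-case : ∀ n k → 27 ≤ n → n < 126 → 1 ≤ k → k ≤ C₂ ((n ∸ 15) / 3) → SmallCase n k
  small-case n (suc j) 27≤n n<126 _ k≤ = applyUpTo⁻ suc _ row k≤
    where
    n≡ : 27 + (n ∸ 27) ≡ n
    n≡ = ℕ.m+[n∸m]≡n 27≤n
    row : Row n
    row = subst Row n≡ (applyUpTo⁻ (27 +_) 99 small-cases (ℕ.+-cancelˡ-< 27 _ 99 (subst (_< 126) (sym n≡) n<126)))

module ContentRange where

  open import Defs using (bound)
  open import Data.Nat.Base as ℕ using (ℕ; zero; suc; _+_; _*_; _∸_; _/_; _≤_; z≤n; s≤s)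
  import Data.Nat.Properties as ℕ
  open import Data.Nat.Tactic.RingSolver using (solve-∀)
  open import Data.Integer.Base as ℤ using (ℤ; +_; -_) renaming (_≤_ to _≤ℤ_)
  import Data.Integer.Properties as ℤ
  open import Data.List.Base using (_∷_; [])
  open import Data.List.Relation.Unary.Any as Any using ()
  open import Data.Product.Base using (_,_)
  open import Data.Sum.Base using (inj₁; inj₂)
  open import Data.Unit.Base using (tt)
  open import Relation.Binary.PropositionalEquality
  open import Relation.Nullary using (yes; no)
  open import Relation.Nullary.Negation using (contradiction)
  open Choose2
  open Frobenius
  open Generic
  open Bound
  open SmallCases

  private
    self-conjugate : ∀ h p → p ≤ 1 → 3 ≤ h + h + suc p → FrobeniusWithContent (h + h + suc p) 0
    self-conjugate h       zero       _ _ = ((h , h) ∷ []) , tt , odd h , refl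
      where odd : ∀ h → suc (h + h) + 0 ≡ h + h + 1
            odd = solve-∀
    self-conjugate (suc h) (suc zero) _ _ = ((suc h , suc h) ∷ (0 , 0) ∷ []) , (s≤s z≤n , s≤s z≤n , tt) , even h , refl
      where even : ∀ h → suc (suc h + suc h) + (1 + 0) ≡ suc h + suc h + 2
            even = solve-∀
    self-conjugate zero    (suc zero) _          (s≤s (s≤s ()))
    self-conjugate _       (suc (suc _)) (s≤s ()) _

  frobenius-zero : ∀ n → 3 ≤ n → FrobeniusWithContent n 0
  frobenius-zero n 3≤n = subst (λ n → FrobeniusWithContent n 0) (sym n≡)
    (self-conjugate (half n) (parity n) (parity≤1 n) (subst (3 ≤_) n≡ 3≤n))
    where
    n≡ : n ≡ half n + half n + suc (parity n)
    n≡ = half-parity n (ℕ.≤-trans (s≤s z≤n) 3≤n)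

  frobenius-positive : ∀ n k → 27 ≤ n → 1 ≤ k → k ≤ C₂ ((n ∸ 15) / 3) → FrobeniusWithContent n k
  frobenius-positive n k 27≤n 1≤k k≤ with 3 * (k / suc (half n)) + 6 * parity n + 20 ℕ.≤? half n
  ... | yes roomy = frobenius-generic (half n) (parity n) (parity≤1 n) (half-parity n (ℕ.≤-trans (s≤s z≤n) 27≤n)) roomy 1≤k
  ... | no  crowded with n ℕ.<? 126
  ...   | no  n≮126 = contradiction (generic-applies-for-large n k (ℕ.≮⇒≥ n≮126) k≤) crowded
  ...   | yes n<126 with small-case n k 27≤n n<126 1≤k k≤
  ...     | inj₁ roomy = contradiction roomy crowded
  ...     | inj₂ found = Any.satisfied found

  partition-with-content : ∀ n → 27 ≤ n → ∀ k → - (+ bound n) ≤ℤ k → k ≤ℤ + bound n → PartitionWithContent n k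
  partition-with-content n 27≤n (ℤ.+ zero)  _     _     = frobenius⇒partition (frobenius-zero n (ℕ.≤-trans (s≤s (s≤s (s≤s z≤n))) 27≤n))
  partition-with-content n 27≤n ℤ.+[1+ k ]  _     upper = frobenius⇒partition (frobenius-positive n (suc k) 27≤n (s≤s z≤n)
    (subst (suc k ≤_) (C≡C₂ ((n ∸ 15) / 3)) (ℤ.drop‿+≤+ upper)))
  partition-with-content n 27≤n ℤ.-[1+ k ]  lower _     = frobenius⇒partition⁻ (frobenius-positive n (suc k) 27≤n (s≤s z≤n)
    (subst (suc k ≤_) (C≡C₂ ((n ∸ 15) / 3)) (ℤ.drop‿+≤+ (ℤ.neg-cancel-≤ lower))))

open import Defs
open import Data.Nat using (ℕ; _≤_)
open import Data.Integer using (ℤ; -_; +_) renaming (_≤_ to _≤ℤ_)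
open import Data.Product.Base using (_,_)
open import Relation.Binary.PropositionalEquality using (refl)
open ContentRange using (partition-with-content)
open Eigenvector using (partition-content-eigenvalue)

theorem1p4 : ∀ (n : ℕ) → 27 ≤ n → ∀ (k : ℤ) → - (+ bound n) ≤ℤ k → k ≤ℤ + bound n → IsTranspositionGraphEigenvalue n k
theorem1p4 n 27≤n k lower upper with partition-with-content n 27≤n k lower upper
... | cs , cs-partition , refl , refl = partition-content-eigenvalue cs cs-partition
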